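{- If $m$ and $n$ are non-negative integers and $s, t$ are integers, then \[ L_t \sum_{k = 0}^n \binom{m - 2n + 2k}{2k}\frac{F_s^{2(n - k)} L_s^{2k}}{5^{k}} - F_t \sum_{k = 1}^n \binom{m - 2n + 2k - 1}{2k - 1} \frac{F_s^{2(n - k) + 1} L_s^{2k - 1}}{5^{k - 1}} =\Big(\frac{4}{5}\Big)^{n}\sum_{k = 0}^{2n} (-1)^k \binom{m + 1}{k} \frac{L_s^k L_{s(2n - k) + t}}{2^{k}}, \] \[ F_t \sum_{k = 0}^n \binom{m - 2n + 2k}{2k} \frac{F_s^{2(n -k)}L_s^{2k}}{5^k} - L_t \sum_{k = 1}^n \binom{m - 2n + 2k - 1}{2k - 1}\frac{F_s^{2(n - k) + 1} L_s^{2k - 1}}{5^k} = \Big(\frac{4}{5}\Big)^n\sum_{k = 0}^{2n} ( - 1)^k \binom{m + 1}{k} \frac{L_s^k F_{s(2n - k) + t}}{2^k}, \] \[ L_t \sum_{k = 1}^n \binom{m - 2n + 2k}{2k -1}\frac{F_s^{2(n - k)} L_s^{2k - 1}}{ 5^k} - F_t \sum_{k = 0}^{n - 1} \binom{m - 2n + 2k + 1}{2k}\frac{F_s^{2(n - k) - 1} L_s^{2k}}{5^k} =\Big(\frac{4}{5}\Big)^n \sum_{k = 0}^{2n - 1} ( - 1)^{k - 1} \binom{m + 1}{k}\frac{L_s^k L_{s(2n - k - 1) + t}}{2^{k+1}}, \] \[ F_t \sum_{k = 1}^n \binom{m - 2n + 2k}{2k - 1}\frac{F_s^{2(n - k)}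 L_s^{2k - 1}} {5^k} - L_t \sum_{k = 0}^{n - 1} \binom{m - 2n + 2k + 1}{2k}\frac{F_s^{2(n - k) - 1} L_s^{2k}}{5^{k + 1}} = \Big(\frac{4}{5}\Big)^n\sum_{k = 0}^{2n - 1} ( - 1)^{k - 1} \binom{m + 1}{k} \frac{L_s^k F_{s(2n - k - 1) + t}}{2^{k + 1}}. \]
   Context: $F_j$ and $L_j$ denote the Fibonacci and Lucas numbers: $F_0=0,F_1=1$, $L_0=2,L_1=1$, both satisfying $X_j=X_{j-1}+X_{j-2}$, extended to all integer indices via the recurrence (so $F_{ -j}=(-1)^{j+1}F_j$, $L_{ -j}=(-1)^jL_j$). For a complex number $x$ and a non-negative integer $k$, $\binom{x}{k}=x(x-1)\cdots(x-k+1)/k!$ (so the upper index may be negative). -}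

module Defs where

open import Data.Nat as ℕ using (ℕ; zero; suc; _!)
open import Data.Nat.Properties using (_!≢0)
open import Data.Integer as ℤ using (ℤ; +_; -[1+_])
open import Data.Rational as ℚ using (ℚ; _/_; 0ℚ; 1ℚ)

fibN : ℕ → ℕ
fibN 0 = 0
fibN 1 = 1
fibN (suc (suc n)) = fibN (suc n) ℕ.+ fibN n

lucN : ℕ → ℕ
lucN 0 = 2
lucN 1 = 1
lucN (suc (suc n)) = lucN (suc n) ℕ.+ lucN n

negOnePowℤ : ℕ → ℤ
negOnePowℤ zero = + 1
negOnePowℤ (suc j) = ℤ.- negOnePowℤ j

-- Extension to integer indices: F_{-j} = (-1)^{j+1} F_j, L_{-j} = (-1)^j L_j
-- (here -[1+ n ] = -(n+1), so j = n+1)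
F : ℤ → ℤ
F (+ n) = + fibN n
F -[1+ n ] = negOnePowℤ (suc (suc n)) ℤ.* + fibN (suc n)

L : ℤ → ℤ
L (+ n) = + lucN n
L -[1+ n ] = negOnePowℤ (suc n) ℤ.* + lucN (suc n)

ι : ℤ → ℚ
ι z = z / 1

_^ℚ_ : ℚ → ℕ → ℚ
q ^ℚ zero = 1ℚ
q ^ℚ suc k = q ℚ.* (q ^ℚ k)

falling : ℤ → ℕ → ℤ
falling x zero = + 1
falling x (suc k) = falling x k ℤ.* (x ℤ.- + k)

binom : ℤ → ℕ → ℚ
binom x k = (falling x k / (k !)) {{k !≢0}}

sumFrom : ℕ → ℕ → (ℕ → ℚ) → ℚ
sumFrom a zero f = 0ℚ
sumFrom a (suc len) f = f a ℚ.+ sumFrom (suc a) len f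

-- Work in ℚ(√5), where φ j = (L j + F j √5)/2 is the j-th power of the golden ratio. For all u, w
-- and every integer M there is the binomial transform
--   Σ_k C(M+1, k) u^k (w - u)^(N-k) = Σ_j C(M-N+j, j) u^j w^(N-j).
-- Take u = -L s/√5 and w = F s; then u = κ·(-L s/2) and w - u = κ·φ s with κ = 2/√5, so the left
-- side is κ^N Σ_k C(m+1, k) (-L s/2)^k (φ s)^(N-k), and multiplying by 2 φ t = L t + F t √5 turns
-- (φ s)^(N-k) into the Lucas and Fibonacci numbers of index s(N-k) + t. On the right, even powers
-- of u are rational and odd ones are rational multiples of √5, so comparing rational and √5 parts
-- gives the first two identities for N = 2n (where κ^N = (4/5)^n) and the last two for N = 2n - 1.

module Submission where

open import Defs
open import Data.Nat as ℕ using (ℕ; zero; suc; _∸_; _≤_; _<_; z<s; s<s; _!)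
open import Data.Nat.Properties using (_!≢0)
import Data.Nat.Properties as ℕP
open import Data.Integer as ℤ using (ℤ; +_; -[1+_])
import Data.Integer.Properties as ℤP
import Data.Integer.Tactic.RingSolver as ℤ-Solver
open import Data.Rational as ℚ using (ℚ; _/_; _+_; _*_; _-_; -_; 0ℚ; 1ℚ; toℚᵘ; fromℚᵘ)
import Data.Rational.Properties as ℚP
open import Data.Rational.Unnormalised as ℚᵘ using (mkℚᵘ; *≡*)
import Data.Rational.Unnormalised.Properties as ℚᵘP
open import Data.Product using (_×_; _,_; proj₁; proj₂)
open import Data.Product.Properties using (≡-dec)
open import Algebra.Bundles using (CommutativeRing)
open import Level using (0ℓ)
open import Relation.Nullary.Decidable.Core using (dec⇒maybe)
open import Relation.Binary.PropositionalEquality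
open import Tactic.RingSolver using (solve-∀)
open import Tactic.RingSolver.Core.AlmostCommutativeRing using (AlmostCommutativeRing; fromCommutativeRing)

ℚ-ring : AlmostCommutativeRing 0ℓ 0ℓ
ℚ-ring = fromCommutativeRing ℚP.+-*-commutativeRing (λ x → dec⇒maybe (0ℚ ℚ.≟ x))

-- Integers and generalised binomial coefficients in ℚ

module _ where
  open ℚᵘP.≃-Reasoning
  open ℚᵘP using (≃-sym)

  fromℚᵘ-homo-+ : ∀ p q → fromℚᵘ (p ℚᵘ.+ q) ≡ fromℚᵘ p + fromℚᵘ q
  fromℚᵘ-homo-+ p q = ℚP.toℚᵘ-injective (begin
    toℚᵘ (fromℚᵘ (p ℚᵘ.+ q))                ≈⟨ ℚP.toℚᵘ-fromℚᵘ _ ⟩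
    p ℚᵘ.+ q                                ≈⟨ ℚᵘP.+-cong (≃-sym (ℚP.toℚᵘ-fromℚᵘ p)) (≃-sym (ℚP.toℚᵘ-fromℚᵘ q)) ⟩
    toℚᵘ (fromℚᵘ p) ℚᵘ.+ toℚᵘ (fromℚᵘ q)    ≈⟨ ℚP.toℚᵘ-homo-+ (fromℚᵘ p) (fromℚᵘ q) ⟨
    toℚᵘ (fromℚᵘ p + fromℚᵘ q)              ∎)

  fromℚᵘ-homo-* : ∀ p q → fromℚᵘ (p ℚᵘ.* q) ≡ fromℚᵘ p * fromℚᵘ q
  fromℚᵘ-homo-* p q = ℚP.toℚᵘ-injective (begin
    toℚᵘ (fromℚᵘ (p ℚᵘ.* q))                ≈⟨ ℚP.toℚᵘ-fromℚᵘ _ ⟩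
    p ℚᵘ.* q                                ≈⟨ ℚᵘP.*-cong (≃-sym (ℚP.toℚᵘ-fromℚᵘ p)) (≃-sym (ℚP.toℚᵘ-fromℚᵘ q)) ⟩
    toℚᵘ (fromℚᵘ p) ℚᵘ.* toℚᵘ (fromℚᵘ q)    ≈⟨ ℚP.toℚᵘ-homo-* (fromℚᵘ p) (fromℚᵘ q) ⟨
    toℚᵘ (fromℚᵘ p * fromℚᵘ q)              ∎)

  fromℚᵘ-homo‿- : ∀ p → fromℚᵘ (ℚᵘ.- p) ≡ - fromℚᵘ p
  fromℚᵘ-homo‿- p = ℚP.toℚᵘ-injective (begin
    toℚᵘ (fromℚᵘ (ℚᵘ.- p))                  ≈⟨ ℚP.toℚᵘ-fromℚᵘ _ ⟩
    ℚᵘ.- p                                  ≈⟨ ℚᵘP.-‿cong (≃-sym (ℚP.toℚᵘ-fromℚᵘ p)) ⟩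
    ℚᵘ.- toℚᵘ (fromℚᵘ p)                    ≈⟨ ℚP.toℚᵘ-homo‿- (fromℚᵘ p) ⟨
    toℚᵘ (- fromℚᵘ p)                       ∎)

open ≡-Reasoning

-- ι a is, by definition, fromℚᵘ (mkℚᵘ a 0)
ι-homo-+ : ∀ a b → ι (a ℤ.+ b) ≡ ι a + ι b
ι-homo-+ a b = trans (ℚP.fromℚᵘ-cong {mkℚᵘ (a ℤ.+ b) 0} {mkℚᵘ a 0 ℚᵘ.+ mkℚᵘ b 0} (*≡* (lemma a b))) (fromℚᵘ-homo-+ (mkℚᵘ a 0) (mkℚᵘ b 0))
  where
  lemma : ∀ a b → (a ℤ.+ b) ℤ.* + 1 ≡ (a ℤ.* + 1 ℤ.+ b ℤ.* + 1) ℤ.* + 1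
  lemma = ℤ-Solver.solve-∀

ι-homo-* : ∀ a b → ι (a ℤ.* b) ≡ ι a * ι b
ι-homo-* a b = trans (ℚP.fromℚᵘ-cong {mkℚᵘ (a ℤ.* b) 0} {mkℚᵘ a 0 ℚᵘ.* mkℚᵘ b 0} (*≡* refl)) (fromℚᵘ-homo-* (mkℚᵘ a 0) (mkℚᵘ b 0))

ι-homo‿- : ∀ a → ι (ℤ.- a) ≡ - ι a
ι-homo‿- a = trans (ℚP.fromℚᵘ-cong {mkℚᵘ (ℤ.- a) 0} {ℚᵘ.- mkℚᵘ a 0} (*≡* refl)) (fromℚᵘ-homo‿- (mkℚᵘ a 0))

/-*-inverse : ∀ i d .{{_ : ℕ.NonZero d}} → (i / d) * ι (+ d) ≡ ι i
/-*-inverse i (suc d) =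
  trans (sym (fromℚᵘ-homo-* (mkℚᵘ i d) (mkℚᵘ (+ suc d) 0)))
        (ℚP.fromℚᵘ-cong {mkℚᵘ i d ℚᵘ.* mkℚᵘ (+ suc d) 0} {mkℚᵘ i 0} (*≡* (lemma i (+ suc d))))
  where
  lemma : ∀ i d → (i ℤ.* d) ℤ.* + 1 ≡ i ℤ.* (d ℤ.* + 1)
  lemma = ℤ-Solver.solve-∀

*-ι-cancelʳ : ∀ a b d .{{_ : ℕ.NonZero d}} → a * ι (+ d) ≡ b * ι (+ d) → a ≡ b
*-ι-cancelʳ a b d eq = begin
  a                       ≡⟨ lemma a ⟩
  a * ι (+ d) * d⁻¹       ≡⟨ cong (_* d⁻¹) eq ⟩
  b * ι (+ d) * d⁻¹       ≡⟨ lemma b ⟨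
  b                       ∎
  where
  d⁻¹ : ℚ
  d⁻¹ = + 1 / d
  lemma : ∀ x → x ≡ x * ι (+ d) * d⁻¹
  lemma x = begin
    x                     ≡⟨ ℚP.*-identityʳ x ⟨
    x * 1ℚ                ≡⟨ cong (x *_) (/-*-inverse (+ 1) d) ⟨
    x * (d⁻¹ * ι (+ d))   ≡⟨ reorder x d⁻¹ (ι (+ d)) ⟩
    x * ι (+ d) * d⁻¹     ∎
    where
    reorder : ∀ x a b → x * (a * b) ≡ x * b * a
    reorder = solve-∀ ℚ-ring

binom-*-! : ∀ x k → binom x k * ι (+ (k !)) ≡ ι (falling x k)
binom-*-! x k = /-*-inverse (falling x k) (k !) {{k !≢0}}

falling-suc : ∀ x k → falling (+ 1 ℤ.+ x) (suc k) ≡ (+ 1 ℤ.+ x) ℤ.* falling x k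
falling-suc x zero = lemma x
  where
  lemma : ∀ x → + 1 ℤ.* ((+ 1 ℤ.+ x) ℤ.- + 0) ≡ (+ 1 ℤ.+ x) ℤ.* + 1
  lemma = ℤ-Solver.solve-∀
falling-suc x (suc k) =
  trans (cong (ℤ._* ((+ 1 ℤ.+ x) ℤ.- + suc k)) (falling-suc x k)) (lemma x (falling x k) (+ k))
  where
  lemma : ∀ x f k → (+ 1 ℤ.+ x) ℤ.* f ℤ.* ((+ 1 ℤ.+ x) ℤ.- (+ 1 ℤ.+ k)) ≡ (+ 1 ℤ.+ x) ℤ.* (f ℤ.* (x ℤ.- k))
  lemma = ℤ-Solver.solve-∀

binom-pascal : ∀ x j → binom (+ 1 ℤ.+ x) (suc j) ≡ binom x j + binom x (suc j)
binom-pascal x j = *-ι-cancelʳ _ _ (suc j !) {{suc j !≢0}} (begin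
  binom (+ 1 ℤ.+ x) (suc j) * ι (+ (suc j !))                  ≡⟨ binom-*-! (+ 1 ℤ.+ x) (suc j) ⟩
  ι (falling (+ 1 ℤ.+ x) (suc j))                              ≡⟨ cong ι (falling-suc x j) ⟩
  ι ((+ 1 ℤ.+ x) ℤ.* fⱼ)                                       ≡⟨ cong ι (split x fⱼ (+ j)) ⟩
  ι (fⱼ ℤ.* + suc j ℤ.+ falling x (suc j))                     ≡⟨ ι-homo-+ (fⱼ ℤ.* + suc j) (falling x (suc j)) ⟩
  ι (fⱼ ℤ.* + suc j) + ι (falling x (suc j))                   ≡⟨ cong (_+ ι (falling x (suc j))) (ι-homo-* fⱼ (+ suc j)) ⟩
  ι fⱼ * ι (+ suc j) + ι (falling x (suc j))                   ≡⟨ cong₂ (λ a b → a * ι (+ suc j) + b) (binom-*-! x j) (binom-*-! x (suc j)) ⟨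
  binom x j * j! * ι (+ suc j) + binom x (suc j) * ι (+ (suc j !))
    ≡⟨ cong (λ z → binom x j * j! * ι (+ suc j) + binom x (suc j) * z) suc-j! ⟩
  binom x j * j! * ι (+ suc j) + binom x (suc j) * (ι (+ suc j) * j!)
    ≡⟨ collect (binom x j) (binom x (suc j)) j! (ι (+ suc j)) ⟩
  (binom x j + binom x (suc j)) * (ι (+ suc j) * j!)           ≡⟨ cong ((binom x j + binom x (suc j)) *_) suc-j! ⟨
  (binom x j + binom x (suc j)) * ι (+ (suc j !))              ∎)
  where
  fⱼ : ℤ
  fⱼ = falling x j
  j! : ℚ
  j! = ι (+ (j !))
  suc-j! : ι (+ (suc j !)) ≡ ι (+ suc j) * j!
  suc-j! = trans (cong ι (ℤP.pos-* (suc j) (j !))) (ι-homo-* (+ suc j) (+ (j !)))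
  split : ∀ x f j → (+ 1 ℤ.+ x) ℤ.* f ≡ f ℤ.* (+ 1 ℤ.+ j) ℤ.+ f ℤ.* (x ℤ.- j)
  split = ℤ-Solver.solve-∀
  collect : ∀ a b c d → a * c * d + b * (d * c) ≡ (a + b) * (d * c)
  collect = solve-∀ ℚ-ring

-- The field ℚ(√5)

-- (a , b) stands for a + b√5
ℚ√5 : Set
ℚ√5 = ℚ × ℚ

infixl 6 _⊕_
infixl 7 _⊗_
infix  8 ⊖_
infixr 8 _^_

_⊕_ : ℚ√5 → ℚ√5 → ℚ√5
(a , b) ⊕ (c , d) = (a + c , b + d)

_⊗_ : ℚ√5 → ℚ√5 → ℚ√5
(a , b) ⊗ (c , d) = (a * c + + 5 / 1 * (b * d) , a * d + b * c)

⊖_ : ℚ√5 → ℚ√5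
⊖ (a , b) = (- a , - b)

𝟘 𝟙 : ℚ√5
𝟘 = (0ℚ , 0ℚ)
𝟙 = (1ℚ , 0ℚ)

ι√ : ℚ → ℚ√5
ι√ q = (q , 0ℚ)

private
  module Component where
    +-assoc : ∀ a b c → a + b + c ≡ a + (b + c)
    +-assoc = solve-∀ ℚ-ring
    +-comm : ∀ a b → a + b ≡ b + a
    +-comm = solve-∀ ℚ-ring
    +-identityˡ : ∀ a → 0ℚ + a ≡ a
    +-identityˡ = solve-∀ ℚ-ring
    +-identityʳ : ∀ a → a + 0ℚ ≡ a
    +-identityʳ = solve-∀ ℚ-ring
    -‿inverseˡ : ∀ a → - a + a ≡ 0ℚ
    -‿inverseˡ = solve-∀ ℚ-ring
    -‿inverseʳ : ∀ a → a + - a ≡ 0ℚ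
    -‿inverseʳ = solve-∀ ℚ-ring
    *-assoc₁ : ∀ a b c d e f → (a * c + + 5 / 1 * (b * d)) * e + + 5 / 1 * ((a * d + b * c) * f)
                             ≡ a * (c * e + + 5 / 1 * (d * f)) + + 5 / 1 * (b * (c * f + d * e))
    *-assoc₁ = solve-∀ ℚ-ring
    *-assoc₂ : ∀ a b c d e f → (a * c + + 5 / 1 * (b * d)) * f + (a * d + b * c) * e
                             ≡ a * (c * f + d * e) + b * (c * e + + 5 / 1 * (d * f))
    *-assoc₂ = solve-∀ ℚ-ring
    *-identityˡ₁ : ∀ a b → 1ℚ * a + + 5 / 1 * (0ℚ * b) ≡ a
    *-identityˡ₁ = solve-∀ ℚ-ring
    *-identityˡ₂ : ∀ a b → 1ℚ * b + 0ℚ * a ≡ b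
    *-identityˡ₂ = solve-∀ ℚ-ring
    *-identityʳ₁ : ∀ a b → a * 1ℚ + + 5 / 1 * (b * 0ℚ) ≡ a
    *-identityʳ₁ = solve-∀ ℚ-ring
    *-identityʳ₂ : ∀ a b → a * 0ℚ + b * 1ℚ ≡ b
    *-identityʳ₂ = solve-∀ ℚ-ring
    distribˡ₁ : ∀ a b c d e f → a * (c + e) + + 5 / 1 * (b * (d + f))
                              ≡ (a * c + + 5 / 1 * (b * d)) + (a * e + + 5 / 1 * (b * f))
    distribˡ₁ = solve-∀ ℚ-ring
    distribˡ₂ : ∀ a b c d e f → a * (d + f) + b * (c + e) ≡ (a * d + b * c) + (a * f + b * e)
    distribˡ₂ = solve-∀ ℚ-ring
    distribʳ₁ : ∀ a b c d e f → (c + e) * a + + 5 / 1 * ((d + f) * b)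
                              ≡ (c * a + + 5 / 1 * (d * b)) + (e * a + + 5 / 1 * (f * b))
    distribʳ₁ = solve-∀ ℚ-ring
    distribʳ₂ : ∀ a b c d e f → (c + e) * b + (d + f) * a ≡ (c * b + d * a) + (e * b + f * a)
    distribʳ₂ = solve-∀ ℚ-ring
    *-comm₁ : ∀ a b c d → a * c + + 5 / 1 * (b * d) ≡ c * a + + 5 / 1 * (d * b)
    *-comm₁ = solve-∀ ℚ-ring
    *-comm₂ : ∀ a b c d → a * d + b * c ≡ c * b + d * a
    *-comm₂ = solve-∀ ℚ-ring

ℚ√5-commutativeRing : CommutativeRing 0ℓ 0ℓ
ℚ√5-commutativeRing = record
  { Carrier = ℚ√5 ; _≈_ = _≡_ ; _+_ = _⊕_ ; _*_ = _⊗_ ; -_ = ⊖_ ; 0# = 𝟘 ; 1# = 𝟙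
  ; isCommutativeRing = record
    { isRing = record
      { +-isAbelianGroup = record
        { isGroup = record
          { isMonoid = record
            { isSemigroup = record
              { isMagma = record { isEquivalence = isEquivalence ; ∙-cong = cong₂ _⊕_ }
              ; assoc = λ (a , b) (c , d) (e , f) → cong₂ _,_ (+-assoc a c e) (+-assoc b d f)
              }
            ; identity = (λ (a , b) → cong₂ _,_ (+-identityˡ a) (+-identityˡ b))
                       , (λ (a , b) → cong₂ _,_ (+-identityʳ a) (+-identityʳ b))
            }
          ; inverse = (λ (a , b) → cong₂ _,_ (-‿inverseˡ a) (-‿inverseˡ b))
                    , (λ (a , b) → cong₂ _,_ (-‿inverseʳ a) (-‿inverseʳ b))
          ; ⁻¹-cong = cong ⊖_
          }
        ; comm = λ (a , b) (c , d) → cong₂ _,_ (+-comm a c) (+-comm b d)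
        }
      ; *-cong = cong₂ _⊗_
      ; *-assoc = λ (a , b) (c , d) (e , f) → cong₂ _,_ (*-assoc₁ a b c d e f) (*-assoc₂ a b c d e f)
      ; *-identity = (λ (a , b) → cong₂ _,_ (*-identityˡ₁ a b) (*-identityˡ₂ a b))
                   , (λ (a , b) → cong₂ _,_ (*-identityʳ₁ a b) (*-identityʳ₂ a b))
      ; distrib = (λ (a , b) (c , d) (e , f) → cong₂ _,_ (distribˡ₁ a b c d e f) (distribˡ₂ a b c d e f))
                , (λ (a , b) (c , d) (e , f) → cong₂ _,_ (distribʳ₁ a b c d e f) (distribʳ₂ a b c d e f))
      }
    ; *-comm = λ (a , b) (c , d) → cong₂ _,_ (*-comm₁ a b c d) (*-comm₂ a b c d)
    }
  }
  where open Component

ℚ√5-ring : AlmostCommutativeRing 0ℓ 0ℓ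
ℚ√5-ring = fromCommutativeRing ℚ√5-commutativeRing (λ x → dec⇒maybe (≡-dec ℚ._≟_ ℚ._≟_ 𝟘 x))

_^_ : ℚ√5 → ℕ → ℚ√5
x ^ zero  = 𝟙
x ^ suc k = x ⊗ x ^ k

ι√-homo-⊗ : ∀ a b → ι√ (a * b) ≡ ι√ a ⊗ ι√ b
ι√-homo-⊗ a b = cong₂ _,_ (first a b) (second a b)
  where
  first : ∀ a b → a * b ≡ a * b + + 5 / 1 * (0ℚ * 0ℚ)
  first = solve-∀ ℚ-ring
  second : ∀ a b → 0ℚ ≡ a * 0ℚ + 0ℚ * b
  second = solve-∀ ℚ-ring

ι√-⊗ : ∀ q x y → ι√ q ⊗ (x , y) ≡ (q * x , q * y)
ι√-⊗ q x y = cong₂ _,_ (first q x y) (second q x y)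
  where
  first : ∀ q x y → q * x + + 5 / 1 * (0ℚ * y) ≡ q * x
  first = solve-∀ ℚ-ring
  second : ∀ q x y → q * y + 0ℚ * x ≡ q * y
  second = solve-∀ ℚ-ring

^-distrib-⊗ : ∀ x y k → (x ⊗ y) ^ k ≡ x ^ k ⊗ y ^ k
^-distrib-⊗ x y zero    = refl
^-distrib-⊗ x y (suc k) = trans (cong (x ⊗ y ⊗_) (^-distrib-⊗ x y k)) (interchange x y (x ^ k) (y ^ k))
  where
  interchange : ∀ a b c d → a ⊗ b ⊗ (c ⊗ d) ≡ a ⊗ c ⊗ (b ⊗ d)
  interchange = solve-∀ ℚ√5-ring

ι√-^ : ∀ q k → ι√ q ^ k ≡ ι√ (q ^ℚ k)
ι√-^ q zero    = refl
ι√-^ q (suc k) = trans (cong (ι√ q ⊗_) (ι√-^ q k)) (sym (ι√-homo-⊗ q (q ^ℚ k)))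

^-2* : ∀ x k → x ^ (2 ℕ.* k) ≡ (x ⊗ x) ^ k
^-2* x zero    = refl
^-2* x (suc k) = begin
  x ^ (2 ℕ.* suc k)            ≡⟨ cong (x ^_) (ℕP.*-suc 2 k) ⟩
  x ⊗ (x ⊗ x ^ (2 ℕ.* k))      ≡⟨ cong (λ z → x ⊗ (x ⊗ z)) (^-2* x k) ⟩
  x ⊗ (x ⊗ (x ⊗ x) ^ k)        ≡⟨ assoc x x ((x ⊗ x) ^ k) ⟩
  (x ⊗ x) ^ suc k              ∎
  where
  assoc : ∀ a b c → a ⊗ (b ⊗ c) ≡ a ⊗ b ⊗ c
  assoc = solve-∀ ℚ√5-ring

-- Finite sums

sumFrom-shift : ∀ a len f → sumFrom (suc a) len f ≡ sumFrom a len (λ k → f (suc k))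
sumFrom-shift a zero      f = refl
sumFrom-shift a (suc len) f = cong (_+_ (f (suc a))) (sumFrom-shift (suc a) len f)

sumFrom-cong : ∀ len {f g} → (∀ k → k < len → f k ≡ g k) → sumFrom 0 len f ≡ sumFrom 0 len g
sumFrom-cong zero      eq = refl
sumFrom-cong (suc len) {f} {g} eq = cong₂ _+_ (eq 0 z<s) (begin
  sumFrom 1 len f                  ≡⟨ sumFrom-shift 0 len f ⟩
  sumFrom 0 len (λ k → f (suc k))  ≡⟨ sumFrom-cong len (λ k k<len → eq (suc k) (s<s k<len)) ⟩
  sumFrom 0 len (λ k → g (suc k))  ≡⟨ sumFrom-shift 0 len g ⟨
  sumFrom 1 len g                  ∎)

sumFrom-zero : ∀ a len → sumFrom a len (λ _ → 0ℚ) ≡ 0ℚ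
sumFrom-zero a zero      = refl
sumFrom-zero a (suc len) = cong (_+_ 0ℚ) (sumFrom-zero (suc a) len)

*-distribˡ-sumFrom : ∀ c a len f → c * sumFrom a len f ≡ sumFrom a len (λ k → c * f k)
*-distribˡ-sumFrom c a zero      f = ℚP.*-zeroʳ c
*-distribˡ-sumFrom c a (suc len) f =
  trans (ℚP.*-distribˡ-+ c (f a) (sumFrom (suc a) len f)) (cong (_+_ (c * f a)) (*-distribˡ-sumFrom c (suc a) len f))

sumFrom-2* : ∀ n f → sumFrom 0 (2 ℕ.* n) f
           ≡ sumFrom 0 n (λ i → f (2 ℕ.* i)) + sumFrom 0 n (λ i → f (suc (2 ℕ.* i)))
sumFrom-2* zero    f = sym (ℚP.+-identityʳ 0ℚ)
sumFrom-2* (suc n) f = begin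
  sumFrom 0 (2 ℕ.* suc n) f
    ≡⟨ cong (λ len → sumFrom 0 len f) (ℕP.*-suc 2 n) ⟩
  f 0 + (f 1 + sumFrom 2 (2 ℕ.* n) f)
    ≡⟨ cong (λ s → f 0 + (f 1 + s)) (trans (sumFrom-shift 1 (2 ℕ.* n) f) (sumFrom-shift 0 (2 ℕ.* n) (λ k → f (suc k)))) ⟩
  f 0 + (f 1 + sumFrom 0 (2 ℕ.* n) (λ k → f (suc (suc k))))
    ≡⟨ cong (λ s → f 0 + (f 1 + s)) (sumFrom-2* n (λ k → f (suc (suc k)))) ⟩
  f 0 + (f 1 + (sumFrom 0 n (λ i → f (2 ℕ.+ 2 ℕ.* i)) + sumFrom 0 n (λ i → f (3 ℕ.+ 2 ℕ.* i))))
    ≡⟨ regroup (f 0) (f 1) _ _ ⟩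
  (f 0 + sumFrom 0 n (λ i → f (2 ℕ.+ 2 ℕ.* i))) + (f 1 + sumFrom 0 n (λ i → f (3 ℕ.+ 2 ℕ.* i)))
    ≡⟨ cong₂ (λ e o → (f 0 + e) + (f 1 + o)) (tail f) (tail (λ k → f (suc k))) ⟨
  sumFrom 0 (suc n) (λ i → f (2 ℕ.* i)) + sumFrom 0 (suc n) (λ i → f (suc (2 ℕ.* i)))
    ∎
  where
  regroup : ∀ a b c d → a + (b + (c + d)) ≡ (a + c) + (b + d)
  regroup = solve-∀ ℚ-ring
  tail : ∀ g → sumFrom 1 n (λ i → g (2 ℕ.* i)) ≡ sumFrom 0 n (λ i → g (2 ℕ.+ 2 ℕ.* i))
  tail g = trans (sumFrom-shift 0 n _) (sumFrom-cong n (λ i _ → cong g (ℕP.*-suc 2 i)))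

sumFrom-1+2* : ∀ n f → sumFrom 0 (suc (2 ℕ.* n)) f
             ≡ sumFrom 0 (suc n) (λ i → f (2 ℕ.* i)) + sumFrom 0 n (λ i → f (suc (2 ℕ.* i)))
sumFrom-1+2* n f = begin
  f 0 + sumFrom 1 (2 ℕ.* n) f
    ≡⟨ cong (_+_ (f 0)) (trans (sumFrom-shift 0 (2 ℕ.* n) f) (sumFrom-2* n (λ k → f (suc k)))) ⟩
  f 0 + (sumFrom 0 n (λ i → f (suc (2 ℕ.* i))) + sumFrom 0 n (λ i → f (2 ℕ.+ 2 ℕ.* i)))
    ≡⟨ regroup (f 0) _ _ ⟩
  (f 0 + sumFrom 0 n (λ i → f (2 ℕ.+ 2 ℕ.* i))) + sumFrom 0 n (λ i → f (suc (2 ℕ.* i)))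
    ≡⟨ cong (λ e → (f 0 + e) + sumFrom 0 n (λ i → f (suc (2 ℕ.* i)))) evens-tail ⟨
  sumFrom 0 (suc n) (λ i → f (2 ℕ.* i)) + sumFrom 0 n (λ i → f (suc (2 ℕ.* i)))
    ∎
  where
  regroup : ∀ a b c → a + (b + c) ≡ (a + c) + b
  regroup = solve-∀ ℚ-ring
  evens-tail : sumFrom 1 n (λ i → f (2 ℕ.* i)) ≡ sumFrom 0 n (λ i → f (2 ℕ.+ 2 ℕ.* i))
  evens-tail = trans (sumFrom-shift 0 n _) (sumFrom-cong n (λ i _ → cong f (ℕP.*-suc 2 i)))

Σ√ : ℕ → ℕ → (ℕ → ℚ√5) → ℚ√5
Σ√ a len f = (sumFrom a len (λ k → proj₁ (f k)) , sumFrom a len (λ k → proj₂ (f k)))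

Σ√-shift : ∀ a len f → Σ√ (suc a) len f ≡ Σ√ a len (λ k → f (suc k))
Σ√-shift a len f = cong₂ _,_ (sumFrom-shift a len _) (sumFrom-shift a len _)

Σ√-cong : ∀ len {f g} → (∀ k → k < len → f k ≡ g k) → Σ√ 0 len f ≡ Σ√ 0 len g
Σ√-cong len eq = cong₂ _,_ (sumFrom-cong len (λ k k<len → cong proj₁ (eq k k<len)))
                           (sumFrom-cong len (λ k k<len → cong proj₂ (eq k k<len)))

Σ√-ι√ : ∀ a len f → Σ√ a len (λ k → ι√ (f k)) ≡ ι√ (sumFrom a len f)
Σ√-ι√ a len f = cong (sumFrom a len f ,_) (sumFrom-zero a len)

⊗-distribˡ-Σ√ : ∀ x a len f → x ⊗ Σ√ a len f ≡ Σ√ a len (λ k → x ⊗ f k)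
⊗-distribˡ-Σ√ x a zero      f = zeroʳ x
  where
  zeroʳ : ∀ x → x ⊗ 𝟘 ≡ 𝟘
  zeroʳ = solve-∀ ℚ√5-ring
⊗-distribˡ-Σ√ x a (suc len) f =
  trans (distribˡ x (f a) (Σ√ (suc a) len f)) (cong (x ⊗ f a ⊕_) (⊗-distribˡ-Σ√ x (suc a) len f))
  where
  distribˡ : ∀ x y z → x ⊗ (y ⊕ z) ≡ x ⊗ y ⊕ x ⊗ z
  distribˡ = solve-∀ ℚ√5-ring

Σ√-2* : ∀ n f → Σ√ 0 (2 ℕ.* n) f ≡ Σ√ 0 n (λ i → f (2 ℕ.* i)) ⊕ Σ√ 0 n (λ i → f (suc (2 ℕ.* i)))
Σ√-2* n f = cong₂ _,_ (sumFrom-2* n (λ k → proj₁ (f k))) (sumFrom-2* n (λ k → proj₂ (f k)))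

Σ√-1+2* : ∀ n f → Σ√ 0 (suc (2 ℕ.* n)) f ≡ Σ√ 0 (suc n) (λ i → f (2 ℕ.* i)) ⊕ Σ√ 0 n (λ i → f (suc (2 ℕ.* i)))
Σ√-1+2* n f = cong₂ _,_ (sumFrom-1+2* n (λ k → proj₁ (f k))) (sumFrom-1+2* n (λ k → proj₂ (f k)))

Σ√-⊕ : ∀ a len f g → Σ√ a len (λ k → f k ⊕ g k) ≡ Σ√ a len f ⊕ Σ√ a len g
Σ√-⊕ a zero      f g = refl
Σ√-⊕ a (suc len) f g =
  trans (cong (f a ⊕ g a ⊕_) (Σ√-⊕ (suc a) len f g)) (interchange (f a) (g a) (Σ√ (suc a) len f) (Σ√ (suc a) len g))
  where
  interchange : ∀ a b c d → a ⊕ b ⊕ (c ⊕ d) ≡ a ⊕ c ⊕ (b ⊕ d)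
  interchange = solve-∀ ℚ√5-ring

⊗-distribʳ-Σ√ : ∀ z len f → Σ√ 0 len f ⊗ z ≡ Σ√ 0 len (λ k → f k ⊗ z)
⊗-distribʳ-Σ√ z len f =
  trans (⊗-comm (Σ√ 0 len f) z) (trans (⊗-distribˡ-Σ√ z 0 len f) (Σ√-cong len (λ k _ → ⊗-comm z (f k))))
  where
  ⊗-comm : ∀ x y → x ⊗ y ≡ y ⊗ x
  ⊗-comm = solve-∀ ℚ√5-ring

Σ√-ι√-⊗ : ∀ len f z → Σ√ 0 len (λ i → ι√ (f (suc i)) ⊗ z) ≡ ι√ (sumFrom 1 len f) ⊗ z
Σ√-ι√-⊗ len f z = begin
  Σ√ 0 len (λ i → ι√ (f (suc i)) ⊗ z)     ≡⟨ ⊗-distribʳ-Σ√ z len (λ i → ι√ (f (suc i))) ⟨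
  Σ√ 0 len (λ i → ι√ (f (suc i))) ⊗ z     ≡⟨ cong (_⊗ z) (Σ√-ι√ 0 len (λ i → f (suc i))) ⟩
  ι√ (sumFrom 0 len (λ i → f (suc i))) ⊗ z ≡⟨ cong (λ q → ι√ q ⊗ z) (sumFrom-shift 0 len f) ⟨
  ι√ (sumFrom 1 len f) ⊗ z                ∎

sumFrom-^ℚ-suc : ∀ q n (f : ℕ → ℚ) → sumFrom 0 n (λ k → f k * q ^ℚ suc k) ≡ q * sumFrom 0 n (λ k → f k * q ^ℚ k)
sumFrom-^ℚ-suc q n f =
  trans (sumFrom-cong n {λ k → f k * q ^ℚ suc k} (λ k _ → swap (f k) q (q ^ℚ k))) (sym (*-distribˡ-sumFrom q 0 n (λ k → f k * q ^ℚ k)))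
  where
  swap : ∀ a q p → a * (q * p) ≡ q * (a * p)
  swap = solve-∀ ℚ-ring

sumFrom-1-^ℚ : ∀ q n (f : ℕ → ℚ) → sumFrom 1 n (λ k → f k * q ^ℚ k) ≡ q * sumFrom 1 n (λ k → f k * q ^ℚ (k ∸ 1))
sumFrom-1-^ℚ q n f = begin
  sumFrom 1 n (λ k → f k * q ^ℚ k)                   ≡⟨ sumFrom-shift 0 n (λ k → f k * q ^ℚ k) ⟩
  sumFrom 0 n (λ i → f (suc i) * q ^ℚ suc i)         ≡⟨ sumFrom-^ℚ-suc q n (λ i → f (suc i)) ⟩
  q * sumFrom 0 n (λ i → f (suc i) * q ^ℚ i)         ≡⟨ cong (q *_) (sumFrom-shift 0 n (λ k → f k * q ^ℚ (k ∸ 1))) ⟨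
  q * sumFrom 1 n (λ k → f k * q ^ℚ (k ∸ 1))         ∎

-- Homogeneous forms and the binomial transform

homogeneous : (ℕ → ℚ) → ℚ√5 → ℚ√5 → ℕ → ℚ√5
homogeneous c x z N = Σ√ 0 (suc N) (λ k → ι√ (c k) ⊗ x ^ k ⊗ z ^ (N ∸ k))

homogeneous-cong : ∀ N {c d} x z → (∀ k → c k ≡ d k) → homogeneous c x z N ≡ homogeneous d x z N
homogeneous-cong N x z eq = Σ√-cong (suc N) (λ k _ → cong (λ q → ι√ q ⊗ x ^ k ⊗ z ^ (N ∸ k)) (eq k))

homogeneous-+ : ∀ N c d x z → homogeneous (λ k → c k + d k) x z N ≡ homogeneous c x z N ⊕ homogeneous d x z N
homogeneous-+ N c d x z = trans
  (Σ√-cong (suc N) (λ k _ → distribʳ (ι√ (c k)) (ι√ (d k)) (x ^ k) (z ^ (N ∸ k))))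
  (Σ√-⊕ 0 (suc N) (λ k → ι√ (c k) ⊗ x ^ k ⊗ z ^ (N ∸ k)) (λ k → ι√ (d k) ⊗ x ^ k ⊗ z ^ (N ∸ k)))
  where
  distribʳ : ∀ a b p q → (a ⊕ b) ⊗ p ⊗ q ≡ a ⊗ p ⊗ q ⊕ b ⊗ p ⊗ q
  distribʳ = solve-∀ ℚ√5-ring

homogeneous-suc : ∀ N c x z →
  homogeneous c x z (suc N) ≡ ι√ (c 0) ⊗ z ^ suc N ⊕ x ⊗ homogeneous (λ k → c (suc k)) x z N
homogeneous-suc N c x z = cong₂ _⊕_ (⊗-identityʳ (ι√ (c 0)) (z ^ suc N)) (begin
  Σ√ 1 (suc N) term
    ≡⟨ Σ√-shift 0 (suc N) term ⟩
  Σ√ 0 (suc N) (λ k → term (suc k))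
    ≡⟨ Σ√-cong (suc N) (λ k _ → pull (ι√ (c (suc k))) x (x ^ k) (z ^ (N ∸ k))) ⟩
  Σ√ 0 (suc N) (λ k → x ⊗ (ι√ (c (suc k)) ⊗ x ^ k ⊗ z ^ (N ∸ k)))
    ≡⟨ ⊗-distribˡ-Σ√ x 0 (suc N) _ ⟨
  x ⊗ homogeneous (λ k → c (suc k)) x z N
    ∎)
  where
  term : ℕ → ℚ√5
  term k = ι√ (c k) ⊗ x ^ k ⊗ z ^ (suc N ∸ k)
  ⊗-identityʳ : ∀ a b → a ⊗ 𝟙 ⊗ b ≡ a ⊗ b
  ⊗-identityʳ = solve-∀ ℚ√5-ring
  pull : ∀ a x y z → a ⊗ (x ⊗ y) ⊗ z ≡ x ⊗ (a ⊗ y ⊗ z)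
  pull = solve-∀ ℚ√5-ring

homogeneous-snoc : ∀ N c x z →
  homogeneous c x z (suc N) ≡ z ⊗ homogeneous c x z N ⊕ ι√ (c (suc N)) ⊗ x ^ suc N
homogeneous-snoc zero c x z =
  trans (homogeneous-suc 0 c x z) (base (ι√ (c 0)) (ι√ (c 1)) x z)
  where
  base : ∀ a b x z → a ⊗ (z ⊗ 𝟙) ⊕ x ⊗ (b ⊗ 𝟙 ⊗ 𝟙 ⊕ 𝟘) ≡ z ⊗ (a ⊗ 𝟙 ⊗ 𝟙 ⊕ 𝟘) ⊕ b ⊗ (x ⊗ 𝟙)
  base = solve-∀ ℚ√5-ring
homogeneous-snoc (suc N) c x z = begin
  homogeneous c x z (2 ℕ.+ N)
    ≡⟨ homogeneous-suc (suc N) c x z ⟩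
  ι√ (c 0) ⊗ z ^ (2 ℕ.+ N) ⊕ x ⊗ homogeneous c′ x z (suc N)
    ≡⟨ cong (λ h → ι√ (c 0) ⊗ z ^ (2 ℕ.+ N) ⊕ x ⊗ h) (homogeneous-snoc N c′ x z) ⟩
  ι√ (c 0) ⊗ z ^ (2 ℕ.+ N) ⊕ x ⊗ (z ⊗ homogeneous c′ x z N ⊕ ι√ (c (2 ℕ.+ N)) ⊗ x ^ suc N)
    ≡⟨ regroup (ι√ (c 0)) z (z ^ suc N) x (x ^ suc N) (homogeneous c′ x z N) (ι√ (c (2 ℕ.+ N))) ⟩
  z ⊗ (ι√ (c 0) ⊗ z ^ suc N ⊕ x ⊗ homogeneous c′ x z N) ⊕ ι√ (c (2 ℕ.+ N)) ⊗ x ^ (2 ℕ.+ N)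
    ≡⟨ cong (λ h → z ⊗ h ⊕ ι√ (c (2 ℕ.+ N)) ⊗ x ^ (2 ℕ.+ N)) (homogeneous-suc N c x z) ⟨
  z ⊗ homogeneous c x z (suc N) ⊕ ι√ (c (2 ℕ.+ N)) ⊗ x ^ (2 ℕ.+ N)
    ∎
  where
  c′ : ℕ → ℚ
  c′ k = c (suc k)
  regroup : ∀ a z Z x X h b → a ⊗ (z ⊗ Z) ⊕ x ⊗ (z ⊗ h ⊕ b ⊗ X) ≡ z ⊗ (a ⊗ Z ⊕ x ⊗ h) ⊕ b ⊗ (x ⊗ X)
  regroup = solve-∀ ℚ√5-ring

homogeneous-pascal : ∀ K N x z →
  homogeneous (binom (+ 1 ℤ.+ K)) x z (suc N)
    ≡ (z ⊕ x) ⊗ homogeneous (binom K) x z N ⊕ ι√ (binom K (suc N)) ⊗ x ^ suc N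
homogeneous-pascal K N x z = begin
  homogeneous (binom (+ 1 ℤ.+ K)) x z (suc N)
    ≡⟨ homogeneous-suc N (binom (+ 1 ℤ.+ K)) x z ⟩
  ι√ (binom K 0) ⊗ z ^ suc N ⊕ x ⊗ homogeneous (λ k → binom (+ 1 ℤ.+ K) (suc k)) x z N
    ≡⟨ cong (λ h → ι√ (binom K 0) ⊗ z ^ suc N ⊕ x ⊗ h)
         (trans (homogeneous-cong N x z (binom-pascal K)) (homogeneous-+ N (binom K) (λ k → binom K (suc k)) x z)) ⟩
  ι√ (binom K 0) ⊗ z ^ suc N ⊕ x ⊗ (H ⊕ homogeneous (λ k → binom K (suc k)) x z N)
    ≡⟨ regroup (ι√ (binom K 0) ⊗ z ^ suc N) x H _ ⟩
  (ι√ (binom K 0) ⊗ z ^ suc N ⊕ x ⊗ homogeneous (λ k → binom K (suc k)) x z N) ⊕ x ⊗ H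
    ≡⟨ cong (_⊕ x ⊗ H) (trans (sym (homogeneous-suc N (binom K) x z)) (homogeneous-snoc N (binom K) x z)) ⟩
  (z ⊗ H ⊕ ι√ (binom K (suc N)) ⊗ x ^ suc N) ⊕ x ⊗ H
    ≡⟨ collect z x H (ι√ (binom K (suc N)) ⊗ x ^ suc N) ⟩
  (z ⊕ x) ⊗ H ⊕ ι√ (binom K (suc N)) ⊗ x ^ suc N
    ∎
  where
  H : ℚ√5
  H = homogeneous (binom K) x z N
  regroup : ∀ a x h h′ → a ⊕ x ⊗ (h ⊕ h′) ≡ (a ⊕ x ⊗ h′) ⊕ x ⊗ h
  regroup = solve-∀ ℚ√5-ring
  collect : ∀ z x h b → (z ⊗ h ⊕ b) ⊕ x ⊗ h ≡ (z ⊕ x) ⊗ h ⊕ b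
  collect = solve-∀ ℚ√5-ring

-- By Pascal's rule the left side for M satisfies h(N+1) = w·h(N) + C(M, N+1) u^(N+1) with h the
-- left side for M - 1; peeling the last term off the right side gives the same recursion.
binomial-transform : ∀ N M u w →
  homogeneous (binom (+ 1 ℤ.+ M)) u (w ⊕ ⊖ u) N ≡ homogeneous (λ j → binom (M ℤ.- + N ℤ.+ + j) j) u w N
binomial-transform zero    M u w = refl
binomial-transform (suc N) M u w = begin
  homogeneous (binom (+ 1 ℤ.+ M)) u (w ⊕ ⊖ u) (suc N)
    ≡⟨ homogeneous-pascal M N u (w ⊕ ⊖ u) ⟩
  (w ⊕ ⊖ u ⊕ u) ⊗ homogeneous (binom M) u (w ⊕ ⊖ u) N ⊕ ι√ (binom M (suc N)) ⊗ u ^ suc N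
    ≡⟨ cong₂ (λ y h → y ⊗ h ⊕ ι√ (binom M (suc N)) ⊗ u ^ suc N) (cancel w u) induction ⟩
  w ⊗ homogeneous (λ j → binom (M ℤ.- + 1 ℤ.- + N ℤ.+ + j) j) u w N ⊕ ι√ (binom M (suc N)) ⊗ u ^ suc N
    ≡⟨ cong₂ (λ h K → w ⊗ h ⊕ ι√ (binom K (suc N)) ⊗ u ^ suc N)
         (homogeneous-cong N u w (λ j → cong (λ K → binom K j) (reassoc M (+ N) (+ j))))
         (uncancel M (+ N)) ⟩
  w ⊗ homogeneous c u w N ⊕ ι√ (c (suc N)) ⊗ u ^ suc N
    ≡⟨ homogeneous-snoc N c u w ⟨
  homogeneous c u w (suc N)
    ∎
  where
  c : ℕ → ℚ
  c j = binom (M ℤ.- + suc N ℤ.+ + j) j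
  cancel : ∀ w u → w ⊕ ⊖ u ⊕ u ≡ w
  cancel = solve-∀ ℚ√5-ring
  pred-suc : ∀ M → M ≡ + 1 ℤ.+ (M ℤ.- + 1)
  pred-suc = ℤ-Solver.solve-∀
  reassoc : ∀ M n j → M ℤ.- + 1 ℤ.- n ℤ.+ j ≡ M ℤ.- (+ 1 ℤ.+ n) ℤ.+ j
  reassoc = ℤ-Solver.solve-∀
  uncancel : ∀ M n → M ≡ M ℤ.- (+ 1 ℤ.+ n) ℤ.+ (+ 1 ℤ.+ n)
  uncancel = ℤ-Solver.solve-∀
  induction : homogeneous (binom M) u (w ⊕ ⊖ u) N ≡ homogeneous (λ j → binom (M ℤ.- + 1 ℤ.- + N ℤ.+ + j) j) u w N
  induction = trans (homogeneous-cong N u (w ⊕ ⊖ u) (λ k → cong (λ K → binom K k) (pred-suc M)))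
                    (binomial-transform N (M ℤ.- + 1) u w)

homogeneous-scale : ∀ N c l x z → homogeneous c (l ⊗ x) (l ⊗ z) N ≡ l ^ N ⊗ homogeneous c x z N
homogeneous-scale zero    c l x z = ⊗-identityˡ (homogeneous c x z 0)
  where
  ⊗-identityˡ : ∀ h → h ≡ 𝟙 ⊗ h
  ⊗-identityˡ = solve-∀ ℚ√5-ring
homogeneous-scale (suc N) c l x z = begin
  homogeneous c (l ⊗ x) (l ⊗ z) (suc N)
    ≡⟨ homogeneous-suc N c (l ⊗ x) (l ⊗ z) ⟩
  ι√ (c 0) ⊗ (l ⊗ z) ^ suc N ⊕ l ⊗ x ⊗ homogeneous c′ (l ⊗ x) (l ⊗ z) N
    ≡⟨ cong₂ (λ p h → ι√ (c 0) ⊗ p ⊕ l ⊗ x ⊗ h) (^-distrib-⊗ l z (suc N)) (homogeneous-scale N c′ l x z) ⟩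
  ι√ (c 0) ⊗ (l ^ suc N ⊗ z ^ suc N) ⊕ l ⊗ x ⊗ (l ^ N ⊗ homogeneous c′ x z N)
    ≡⟨ factor (ι√ (c 0)) l (l ^ N) x (z ^ suc N) (homogeneous c′ x z N) ⟩
  l ^ suc N ⊗ (ι√ (c 0) ⊗ z ^ suc N ⊕ x ⊗ homogeneous c′ x z N)
    ≡⟨ cong (l ^ suc N ⊗_) (homogeneous-suc N c x z) ⟨
  l ^ suc N ⊗ homogeneous c x z (suc N)
    ∎
  where
  c′ : ℕ → ℚ
  c′ k = c (suc k)
  factor : ∀ a l L x Z h → a ⊗ (l ⊗ L ⊗ Z) ⊕ l ⊗ x ⊗ (L ⊗ h) ≡ l ⊗ L ⊗ (a ⊗ Z ⊕ x ⊗ h)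
  factor = solve-∀ ℚ√5-ring

-- Lucas and Fibonacci numbers through the golden ratio

fibN-suc : ∀ k → + 2 ℤ.* + fibN (suc k) ≡ + lucN k ℤ.+ + fibN k
fibN-suc 0             = refl
fibN-suc 1             = refl
fibN-suc (suc (suc k)) = begin
  + 2 ℤ.* (+ fibN (2 ℕ.+ k) ℤ.+ + fibN (suc k))
    ≡⟨ ℤP.*-distribˡ-+ (+ 2) (+ fibN (2 ℕ.+ k)) (+ fibN (suc k)) ⟩
  + 2 ℤ.* + fibN (2 ℕ.+ k) ℤ.+ + 2 ℤ.* + fibN (suc k)
    ≡⟨ cong₂ ℤ._+_ (fibN-suc (suc k)) (fibN-suc k) ⟩
  (+ lucN (suc k) ℤ.+ + fibN (suc k)) ℤ.+ (+ lucN k ℤ.+ + fibN k)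
    ≡⟨ interchange (+ lucN (suc k)) (+ fibN (suc k)) (+ lucN k) (+ fibN k) ⟩
  (+ lucN (suc k) ℤ.+ + lucN k) ℤ.+ (+ fibN (suc k) ℤ.+ + fibN k)
    ∎
  where
  interchange : ∀ a b c d → (a ℤ.+ b) ℤ.+ (c ℤ.+ d) ≡ (a ℤ.+ c) ℤ.+ (b ℤ.+ d)
  interchange = ℤ-Solver.solve-∀

lucN-suc : ∀ k → + 2 ℤ.* + lucN (suc k) ≡ + lucN k ℤ.+ + 5 ℤ.* + fibN k
lucN-suc 0             = refl
lucN-suc 1             = refl
lucN-suc (suc (suc k)) = begin
  + 2 ℤ.* (+ lucN (2 ℕ.+ k) ℤ.+ + lucN (suc k))
    ≡⟨ ℤP.*-distribˡ-+ (+ 2) (+ lucN (2 ℕ.+ k)) (+ lucN (suc k)) ⟩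
  + 2 ℤ.* + lucN (2 ℕ.+ k) ℤ.+ + 2 ℤ.* + lucN (suc k)
    ≡⟨ cong₂ ℤ._+_ (lucN-suc (suc k)) (lucN-suc k) ⟩
  (+ lucN (suc k) ℤ.+ + 5 ℤ.* + fibN (suc k)) ℤ.+ (+ lucN k ℤ.+ + 5 ℤ.* + fibN k)
    ≡⟨ interchange (+ lucN (suc k)) (+ fibN (suc k)) (+ lucN k) (+ fibN k) ⟩
  (+ lucN (suc k) ℤ.+ + lucN k) ℤ.+ + 5 ℤ.* (+ fibN (suc k) ℤ.+ + fibN k)
    ∎
  where
  interchange : ∀ a b c d → (a ℤ.+ + 5 ℤ.* b) ℤ.+ (c ℤ.+ + 5 ℤ.* d) ≡ (a ℤ.+ c) ℤ.+ + 5 ℤ.* (b ℤ.+ d)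
  interchange = ℤ-Solver.solve-∀

½ : ℚ
½ = + 1 / 2

φ : ℤ → ℚ√5
φ j = (½ * ι (L j) , ½ * ι (F j))

golden : ℚ√5
golden = (½ , ½)

conj : ℚ√5 → ℚ√5
conj (a , b) = (a , - b)

conj-⊗ : ∀ x y → conj (x ⊗ y) ≡ conj x ⊗ conj y
conj-⊗ (a , b) (c , d) = cong₂ _,_ (first a b c d) (second a b c d)
  where
  first : ∀ a b c d → a * c + + 5 / 1 * (b * d) ≡ a * c + + 5 / 1 * (- b * - d)
  first = solve-∀ ℚ-ring
  second : ∀ a b c d → - (a * d + b * c) ≡ a * - d + - b * c
  second = solve-∀ ℚ-ring

φ-suc-ℕ : ∀ n → φ (+ suc n) ≡ φ (+ n) ⊗ golden
φ-suc-ℕ n = cong₂ _,_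
  (trans (half (ι (+ lucN (suc n)))) (trans (cong (½ * ½ *_) double-L) (spreadL (ι (+ lucN n)) (ι (+ fibN n)))))
  (trans (half (ι (+ fibN (suc n)))) (trans (cong (½ * ½ *_) double-F) (spreadF (ι (+ lucN n)) (ι (+ fibN n)))))
  where
  double-L : ι (+ 2) * ι (+ lucN (suc n)) ≡ ι (+ lucN n) + ι (+ 5) * ι (+ fibN n)
  double-L = begin
    ι (+ 2) * ι (+ lucN (suc n))              ≡⟨ ι-homo-* (+ 2) (+ lucN (suc n)) ⟨
    ι (+ 2 ℤ.* + lucN (suc n))                ≡⟨ cong ι (lucN-suc n) ⟩
    ι (+ lucN n ℤ.+ + 5 ℤ.* + fibN n)         ≡⟨ ι-homo-+ (+ lucN n) (+ 5 ℤ.* + fibN n) ⟩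
    ι (+ lucN n) + ι (+ 5 ℤ.* + fibN n)       ≡⟨ cong (_+_ (ι (+ lucN n))) (ι-homo-* (+ 5) (+ fibN n)) ⟩
    ι (+ lucN n) + ι (+ 5) * ι (+ fibN n)     ∎
  double-F : ι (+ 2) * ι (+ fibN (suc n)) ≡ ι (+ lucN n) + ι (+ fibN n)
  double-F = trans (sym (ι-homo-* (+ 2) (+ fibN (suc n)))) (trans (cong ι (fibN-suc n)) (ι-homo-+ (+ lucN n) (+ fibN n)))
  half : ∀ x → ½ * x ≡ ½ * ½ * (+ 2 / 1 * x)
  half = solve-∀ ℚ-ring
  spreadL : ∀ a b → ½ * ½ * (a + + 5 / 1 * b) ≡ ½ * a * ½ + + 5 / 1 * (½ * b * ½)
  spreadL = solve-∀ ℚ-ring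
  spreadF : ∀ a b → ½ * ½ * (a + b) ≡ ½ * a * ½ + ½ * b * ½
  spreadF = solve-∀ ℚ-ring

φ-neg : ∀ n → φ -[1+ n ] ≡ ι√ (ι (negOnePowℤ (suc n))) ⊗ conj (φ (+ suc n))
φ-neg n = begin
  (½ * ι (σ ℤ.* + l) , ½ * ι (ℤ.- σ ℤ.* + f))
    ≡⟨ cong₂ (λ p q → (½ * p , ½ * q)) (ι-homo-* σ (+ l))
             (trans (ι-homo-* (ℤ.- σ) (+ f)) (cong (_* ι (+ f)) (ι-homo‿- σ))) ⟩
  (½ * (ι σ * ι (+ l)) , ½ * (- ι σ * ι (+ f)))
    ≡⟨ cong₂ _,_ (first (ι σ) (ι (+ l))) (second (ι σ) (ι (+ f))) ⟩
  (ι σ * (½ * ι (+ l)) , ι σ * - (½ * ι (+ f)))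
    ≡⟨ ι√-⊗ (ι σ) (½ * ι (+ l)) (- (½ * ι (+ f))) ⟨
  ι√ (ι σ) ⊗ conj (φ (+ suc n))
    ∎
  where
  σ : ℤ
  σ = negOnePowℤ (suc n)
  l f : ℕ
  l = lucN (suc n)
  f = fibN (suc n)
  first : ∀ s x → ½ * (s * x) ≡ s * (½ * x)
  first = solve-∀ ℚ-ring
  second : ∀ s x → ½ * (- s * x) ≡ s * - (½ * x)
  second = solve-∀ ℚ-ring

φ-suc : ∀ j → φ (j ℤ.+ + 1) ≡ φ j ⊗ golden
φ-suc (+ n)            = trans (cong (λ k → φ (+ k)) (ℕP.+-comm n 1)) (φ-suc-ℕ n)
φ-suc -[1+ 0 ]         = refl
φ-suc -[1+ suc n ]     = begin
  φ -[1+ n ]                                                    ≡⟨ φ-neg n ⟩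
  ι√ s ⊗ conj (φ (+ suc n))                                     ≡⟨ flip (ι√ s) (conj (φ (+ suc n))) ⟩
  ⊖ ι√ s ⊗ (conj (φ (+ suc n)) ⊗ conj golden) ⊗ golden          ≡⟨ cong (λ z → ⊖ ι√ s ⊗ z ⊗ golden) (conj-⊗ (φ (+ suc n)) golden) ⟨
  ⊖ ι√ s ⊗ conj (φ (+ suc n) ⊗ golden) ⊗ golden                 ≡⟨ cong (λ z → ⊖ ι√ s ⊗ conj z ⊗ golden) (φ-suc-ℕ (suc n)) ⟨
  ⊖ ι√ s ⊗ conj (φ (+ suc (suc n))) ⊗ golden                    ≡⟨ cong (λ z → ι√ z ⊗ conj (φ (+ suc (suc n))) ⊗ golden) (ι-homo‿- (negOnePowℤ (suc n))) ⟨
  ι√ (ι (negOnePowℤ (suc (suc n)))) ⊗ conj (φ (+ suc (suc n))) ⊗ golden  ≡⟨ cong (_⊗ golden) (φ-neg (suc n)) ⟨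
  φ -[1+ suc n ] ⊗ golden                                       ∎
  where
  s : ℚ
  s = ι (negOnePowℤ (suc n))
  -- conj golden ⊗ golden = -1
  flip : ∀ a c → a ⊗ c ≡ ⊖ a ⊗ (c ⊗ conj golden) ⊗ golden
  flip = solve-∀ ℚ√5-ring

golden⁻¹ : ℚ√5
golden⁻¹ = φ -[1+ 0 ]

φ-pred : ∀ j → φ (j ℤ.+ -[1+ 0 ]) ≡ φ j ⊗ golden⁻¹
φ-pred j = begin
  φ (j ℤ.+ -[1+ 0 ])                        ≡⟨ unit (φ (j ℤ.+ -[1+ 0 ])) ⟩
  φ (j ℤ.+ -[1+ 0 ]) ⊗ golden ⊗ golden⁻¹    ≡⟨ cong (_⊗ golden⁻¹) (φ-suc (j ℤ.+ -[1+ 0 ])) ⟨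
  φ (j ℤ.+ -[1+ 0 ] ℤ.+ + 1) ⊗ golden⁻¹     ≡⟨ cong (λ i → φ i ⊗ golden⁻¹) (pred-suc j) ⟩
  φ j ⊗ golden⁻¹                            ∎
  where
  unit : ∀ x → x ≡ x ⊗ golden ⊗ golden⁻¹
  unit = solve-∀ ℚ√5-ring
  pred-suc : ∀ j → j ℤ.+ -[1+ 0 ] ℤ.+ + 1 ≡ j
  pred-suc = ℤ-Solver.solve-∀

φ-+ : ∀ i j → φ (i ℤ.+ j) ≡ φ i ⊗ φ j
φ-+ i (+ zero)       = trans (cong φ (ℤP.+-identityʳ i)) (⊗-identityʳ (φ i))
  where
  ⊗-identityʳ : ∀ x → x ≡ x ⊗ 𝟙
  ⊗-identityʳ = solve-∀ ℚ√5-ring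
φ-+ i (+ suc k)      = begin
  φ (i ℤ.+ + suc k)           ≡⟨ cong φ (reassoc i (+ k)) ⟩
  φ (i ℤ.+ + k ℤ.+ + 1)       ≡⟨ φ-suc (i ℤ.+ + k) ⟩
  φ (i ℤ.+ + k) ⊗ golden      ≡⟨ cong (_⊗ golden) (φ-+ i (+ k)) ⟩
  φ i ⊗ φ (+ k) ⊗ golden      ≡⟨ assoc (φ i) (φ (+ k)) golden ⟩
  φ i ⊗ (φ (+ k) ⊗ golden)    ≡⟨ cong (φ i ⊗_) (φ-suc-ℕ k) ⟨
  φ i ⊗ φ (+ suc k)           ∎
  where
  reassoc : ∀ i k → i ℤ.+ (+ 1 ℤ.+ k) ≡ i ℤ.+ k ℤ.+ + 1
  reassoc = ℤ-Solver.solve-∀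
  assoc : ∀ x y z → x ⊗ y ⊗ z ≡ x ⊗ (y ⊗ z)
  assoc = solve-∀ ℚ√5-ring
φ-+ i -[1+ zero ]    = φ-pred i
φ-+ i -[1+ suc k ]   = begin
  φ (i ℤ.+ -[1+ suc k ])                 ≡⟨ cong φ reassoc ⟩
  φ (i ℤ.+ -[1+ k ] ℤ.+ -[1+ 0 ])        ≡⟨ φ-pred (i ℤ.+ -[1+ k ]) ⟩
  φ (i ℤ.+ -[1+ k ]) ⊗ golden⁻¹          ≡⟨ cong (_⊗ golden⁻¹) (φ-+ i -[1+ k ]) ⟩
  φ i ⊗ φ -[1+ k ] ⊗ golden⁻¹            ≡⟨ assoc (φ i) (φ -[1+ k ]) golden⁻¹ ⟩
  φ i ⊗ (φ -[1+ k ] ⊗ golden⁻¹)          ≡⟨ cong (φ i ⊗_) (φ-pred -[1+ k ]) ⟨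
  φ i ⊗ φ (-[1+ k ] ℤ.+ -[1+ 0 ])        ≡⟨ cong (λ j → φ i ⊗ φ j) split ⟩
  φ i ⊗ φ -[1+ suc k ]                   ∎
  where
  split : -[1+ k ] ℤ.+ -[1+ 0 ] ≡ -[1+ suc k ]
  split = cong (λ n → -[1+ suc n ]) (ℕP.+-identityʳ k)
  reassoc : i ℤ.+ -[1+ suc k ] ≡ i ℤ.+ -[1+ k ] ℤ.+ -[1+ 0 ]
  reassoc = trans (cong (ℤ._+_ i) (sym split)) (sym (ℤP.+-assoc i -[1+ k ] -[1+ 0 ]))
  assoc : ∀ x y z → x ⊗ y ⊗ z ≡ x ⊗ (y ⊗ z)
  assoc = solve-∀ ℚ√5-ring

φ-^ : ∀ s p t → φ s ^ p ⊗ φ t ≡ φ (s ℤ.* + p ℤ.+ t)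
φ-^ s zero    t = trans (⊗-identityˡ (φ t)) (cong φ (sym (trans (cong (ℤ._+ t) (ℤP.*-zeroʳ s)) (ℤP.+-identityˡ t))))
  where
  ⊗-identityˡ : ∀ x → 𝟙 ⊗ x ≡ x
  ⊗-identityˡ = solve-∀ ℚ√5-ring
φ-^ s (suc p) t = begin
  φ s ⊗ φ s ^ p ⊗ φ t              ≡⟨ assoc (φ s) (φ s ^ p) (φ t) ⟩
  φ s ⊗ (φ s ^ p ⊗ φ t)            ≡⟨ cong (φ s ⊗_) (φ-^ s p t) ⟩
  φ s ⊗ φ (s ℤ.* + p ℤ.+ t)        ≡⟨ φ-+ s (s ℤ.* + p ℤ.+ t) ⟨
  φ (s ℤ.+ (s ℤ.* + p ℤ.+ t))      ≡⟨ cong φ (distrib s (+ p) t) ⟩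
  φ (s ℤ.* + suc p ℤ.+ t)          ∎
  where
  assoc : ∀ x y z → x ⊗ y ⊗ z ≡ x ⊗ (y ⊗ z)
  assoc = solve-∀ ℚ√5-ring
  distrib : ∀ s p t → s ℤ.+ (s ℤ.* p ℤ.+ t) ≡ s ℤ.* (+ 1 ℤ.+ p) ℤ.+ t
  distrib = ℤ-Solver.solve-∀

-- The specialisation u = -Lₛ/√5, w = Fₛ of the binomial transform

⅕ : ℚ
⅕ = + 1 / 5

-- μ = -1/√5 and κ = 2/√5
μ κ : ℚ√5
μ = (0ℚ , - ⅕)
κ = (0ℚ , + 2 / 5)

ψ : ℤ → ℚ√5
ψ j = (ι (L j) , ι (F j))

ψ-φ : ∀ j → ψ j ≡ ι√ (+ 2 / 1) ⊗ φ j
ψ-φ j = sym (trans (ι√-⊗ (+ 2 / 1) (½ * ι (L j)) (½ * ι (F j))) (cong₂ _,_ (double (ι (L j))) (double (ι (F j)))))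
  where
  double : ∀ x → + 2 / 1 * (½ * x) ≡ x
  double = solve-∀ ℚ-ring

ψ-⊗-φ-^ : ∀ s p t → ψ t ⊗ φ s ^ p ≡ ψ (s ℤ.* + p ℤ.+ t)
ψ-⊗-φ-^ s p t = begin
  ψ t ⊗ φ s ^ p                        ≡⟨ cong (_⊗ φ s ^ p) (ψ-φ t) ⟩
  ι√ (+ 2 / 1) ⊗ φ t ⊗ φ s ^ p         ≡⟨ swap (ι√ (+ 2 / 1)) (φ t) (φ s ^ p) ⟩
  ι√ (+ 2 / 1) ⊗ (φ s ^ p ⊗ φ t)       ≡⟨ cong (ι√ (+ 2 / 1) ⊗_) (φ-^ s p t) ⟩
  ι√ (+ 2 / 1) ⊗ φ (s ℤ.* + p ℤ.+ t)   ≡⟨ ψ-φ (s ℤ.* + p ℤ.+ t) ⟨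
  ψ (s ℤ.* + p ℤ.+ t)                  ∎
  where
  swap : ∀ a x y → a ⊗ x ⊗ y ≡ a ⊗ (y ⊗ x)
  swap = solve-∀ ℚ√5-ring

-^ℚ-½ : ∀ x k → (- ½ * x) ^ℚ k ≡ ι (negOnePowℤ k) * x ^ℚ k * ½ ^ℚ k
-^ℚ-½ x zero    = refl
-^ℚ-½ x (suc k) = begin
  - ½ * x * (- ½ * x) ^ℚ k                                   ≡⟨ cong (- ½ * x *_) (-^ℚ-½ x k) ⟩
  - ½ * x * (ι σ * x ^ℚ k * ½ ^ℚ k)                          ≡⟨ reorder (ι σ) x (x ^ℚ k) (½ ^ℚ k) ⟩
  - ι σ * (x * x ^ℚ k) * (½ * ½ ^ℚ k)                        ≡⟨ cong (λ z → z * (x * x ^ℚ k) * (½ * ½ ^ℚ k)) (ι-homo‿- σ) ⟨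
  ι (negOnePowℤ (suc k)) * x ^ℚ suc k * ½ ^ℚ suc k           ∎
  where
  σ : ℤ
  σ = negOnePowℤ k
  reorder : ∀ s x X H → - ½ * x * (s * X * H) ≡ - s * (x * X) * (½ * H)
  reorder = solve-∀ ℚ-ring

μ-^-2* : ∀ i → μ ^ (2 ℕ.* i) ≡ ι√ (⅕ ^ℚ i)
μ-^-2* i = trans (^-2* μ i) (ι√-^ ⅕ i)

ι√-μ-^-2* : ∀ x i → (ι√ x ⊗ μ) ^ (2 ℕ.* i) ≡ ι√ (x ^ℚ (2 ℕ.* i) * ⅕ ^ℚ i)
ι√-μ-^-2* x i = begin
  (ι√ x ⊗ μ) ^ (2 ℕ.* i)                 ≡⟨ ^-distrib-⊗ (ι√ x) μ (2 ℕ.* i) ⟩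
  ι√ x ^ (2 ℕ.* i) ⊗ μ ^ (2 ℕ.* i)       ≡⟨ cong₂ _⊗_ (ι√-^ x (2 ℕ.* i)) (μ-^-2* i) ⟩
  ι√ (x ^ℚ (2 ℕ.* i)) ⊗ ι√ (⅕ ^ℚ i)      ≡⟨ ι√-homo-⊗ (x ^ℚ (2 ℕ.* i)) (⅕ ^ℚ i) ⟨
  ι√ (x ^ℚ (2 ℕ.* i) * ⅕ ^ℚ i)           ∎

ι√-μ-^-1+2* : ∀ x i → (ι√ x ⊗ μ) ^ suc (2 ℕ.* i) ≡ ι√ (x ^ℚ suc (2 ℕ.* i) * ⅕ ^ℚ i) ⊗ μ
ι√-μ-^-1+2* x i = begin
  ι√ x ⊗ μ ⊗ (ι√ x ⊗ μ) ^ (2 ℕ.* i)      ≡⟨ cong (ι√ x ⊗ μ ⊗_) (ι√-μ-^-2* x i) ⟩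
  ι√ x ⊗ μ ⊗ ι√ (X * Z)                  ≡⟨ swap (ι√ x) μ (ι√ (X * Z)) ⟩
  ι√ x ⊗ ι√ (X * Z) ⊗ μ                  ≡⟨ cong (_⊗ μ) (ι√-homo-⊗ x (X * Z)) ⟨
  ι√ (x * (X * Z)) ⊗ μ                   ≡⟨ cong (λ q → ι√ q ⊗ μ) (ℚP.*-assoc x X Z) ⟨
  ι√ (x * X * Z) ⊗ μ                     ∎
  where
  X Z : ℚ
  X = x ^ℚ (2 ℕ.* i)
  Z = ⅕ ^ℚ i
  swap : ∀ a m b → a ⊗ m ⊗ b ≡ a ⊗ b ⊗ m
  swap = solve-∀ ℚ√5-ring

u w : ℤ → ℚ√5
u s = ι√ (ι (L s)) ⊗ μ
w s = ι√ (ι (F s))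

binomial-transform-φ : ∀ N M s →
  homogeneous (λ j → binom (M ℤ.- + N ℤ.+ + j) j) (u s) (w s) N
    ≡ κ ^ N ⊗ homogeneous (binom (+ 1 ℤ.+ M)) (ι√ (- ½ * ι (L s))) (φ s) N
binomial-transform-φ N M s = begin
  homogeneous (λ j → binom (M ℤ.- + N ℤ.+ + j) j) (u s) (w s) N
    ≡⟨ binomial-transform N M (u s) (w s) ⟨
  homogeneous (binom (+ 1 ℤ.+ M)) (u s) (w s ⊕ ⊖ u s) N
    ≡⟨ cong₂ (λ x z → homogeneous (binom (+ 1 ℤ.+ M)) x z N) u≡ w-u≡ ⟩
  homogeneous (binom (+ 1 ℤ.+ M)) (κ ⊗ ι√ (- ½ * Lₛ)) (κ ⊗ φ s) N
    ≡⟨ homogeneous-scale N (binom (+ 1 ℤ.+ M)) κ (ι√ (- ½ * Lₛ)) (φ s) ⟩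
  κ ^ N ⊗ homogeneous (binom (+ 1 ℤ.+ M)) (ι√ (- ½ * Lₛ)) (φ s) N
    ∎
  where
  Lₛ Fₛ : ℚ
  Lₛ = ι (L s)
  Fₛ = ι (F s)
  u≡ : u s ≡ κ ⊗ ι√ (- ½ * Lₛ)
  u≡ = trans (ι√-⊗ Lₛ 0ℚ (- ⅕)) (cong₂ _,_ (first Lₛ) (second Lₛ))
    where
    first : ∀ L → L * 0ℚ ≡ 0ℚ * (- ½ * L) + + 5 / 1 * (+ 2 / 5 * 0ℚ)
    first = solve-∀ ℚ-ring
    second : ∀ L → L * - ⅕ ≡ 0ℚ * 0ℚ + + 2 / 5 * (- ½ * L)
    second = solve-∀ ℚ-ring
  w-u≡ : w s ⊕ ⊖ u s ≡ κ ⊗ φ s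
  w-u≡ = trans (cong (λ v → w s ⊕ ⊖ v) (ι√-⊗ Lₛ 0ℚ (- ⅕))) (cong₂ _,_ (first Lₛ Fₛ) (second Lₛ Fₛ))
    where
    first : ∀ L F → F + - (L * 0ℚ) ≡ 0ℚ * (½ * L) + + 5 / 1 * (+ 2 / 5 * (½ * F))
    first = solve-∀ ℚ-ring
    second : ∀ L F → 0ℚ + - (L * - ⅕) ≡ 0ℚ * (½ * F) + + 2 / 5 * (½ * L)
    second = solve-∀ ℚ-ring

rhsTerm : (ℤ → ℤ) → ℕ → ℕ → ℤ → ℤ → ℕ → ℚ
rhsTerm X m N s t k =
  ι (negOnePowℤ k) * binom (+ suc m) k * (ι (L s) ^ℚ k) * ι (X (s ℤ.* (+ N ℤ.- + k) ℤ.+ t)) * (½ ^ℚ k)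

ψ-⊗-homogeneous : ∀ N m s t →
  ψ t ⊗ homogeneous (binom (+ suc m)) (ι√ (- ½ * ι (L s))) (φ s) N
    ≡ Σ√ 0 (suc N) (λ k → (rhsTerm L m N s t k , rhsTerm F m N s t k))
ψ-⊗-homogeneous N m s t =
  trans (⊗-distribˡ-Σ√ (ψ t) 0 (suc N) _)
        (Σ√-cong (suc N) {g = λ k → (rhsTerm L m N s t k , rhsTerm F m N s t k)} term)
  where
  a : ℚ
  a = - ½ * ι (L s)
  term : ∀ k → k < suc N →
    ψ t ⊗ (ι√ (binom (+ suc m) k) ⊗ ι√ a ^ k ⊗ φ s ^ (N ∸ k)) ≡ (rhsTerm L m N s t k , rhsTerm F m N s t k)
  term k k<1+N = begin
    ψ t ⊗ (ι√ b ⊗ ι√ a ^ k ⊗ φ s ^ (N ∸ k))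
      ≡⟨ swap (ψ t) (ι√ b) (ι√ a ^ k) (φ s ^ (N ∸ k)) ⟩
    ι√ b ⊗ ι√ a ^ k ⊗ (ψ t ⊗ φ s ^ (N ∸ k))
      ≡⟨ cong₂ (λ p q → ι√ b ⊗ p ⊗ q) (ι√-^ a k) (ψ-⊗-φ-^ s (N ∸ k) t) ⟩
    ι√ b ⊗ ι√ (a ^ℚ k) ⊗ ψ (s ℤ.* + (N ∸ k) ℤ.+ t)
      ≡⟨ cong (λ i → ι√ b ⊗ ι√ (a ^ℚ k) ⊗ ψ (s ℤ.* i ℤ.+ t)) N∸k ⟩
    ι√ b ⊗ ι√ (a ^ℚ k) ⊗ ψ j
      ≡⟨ cong (_⊗ ψ j) (ι√-homo-⊗ b (a ^ℚ k)) ⟨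
    ι√ (b * a ^ℚ k) ⊗ ψ j
      ≡⟨ ι√-⊗ (b * a ^ℚ k) (ι (L j)) (ι (F j)) ⟩
    (b * a ^ℚ k * ι (L j) , b * a ^ℚ k * ι (F j))
      ≡⟨ cong (λ e → (b * e * ι (L j) , b * e * ι (F j))) (-^ℚ-½ (ι (L s)) k) ⟩
    (b * (σ * P * H) * ι (L j) , b * (σ * P * H) * ι (F j))
      ≡⟨ cong₂ _,_ (reorder b σ P H (ι (L j))) (reorder b σ P H (ι (F j))) ⟩
    (σ * b * P * ι (L j) * H , σ * b * P * ι (F j) * H)
      ∎
    where
    b σ P H : ℚ
    b = binom (+ suc m) k
    σ = ι (negOnePowℤ k)
    P = ι (L s) ^ℚ k
    H = ½ ^ℚ k
    j : ℤ
    j = s ℤ.* (+ N ℤ.- + k) ℤ.+ t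
    N∸k : + (N ∸ k) ≡ + N ℤ.- + k
    N∸k = sym (trans (ℤP.m-n≡m⊖n N k) (ℤP.⊖-≥ (ℕP.≤-pred k<1+N)))
    swap : ∀ p b e f → p ⊗ (b ⊗ e ⊗ f) ≡ b ⊗ e ⊗ (p ⊗ f)
    swap = solve-∀ ℚ√5-ring
    reorder : ∀ b σ P H X → b * (σ * P * H) * X ≡ σ * b * P * X * H
    reorder = solve-∀ ℚ-ring

2*-∸ : ∀ n k → 2 ℕ.* n ∸ 2 ℕ.* k ≡ 2 ℕ.* (n ∸ k)
2*-∸ n k = sym (ℕP.*-distribˡ-∸ 2 n k)

2*suc∸1 : ∀ i → 2 ℕ.* suc i ∸ 1 ≡ suc (2 ℕ.* i)
2*suc∸1 i = cong (_∸ 1) (ℕP.*-suc 2 i)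

2*∸1+2* : ∀ n i → i < n → 2 ℕ.* n ∸ suc (2 ℕ.* i) ≡ 2 ℕ.* (n ∸ suc i) ℕ.+ 1
2*∸1+2* (suc n) zero    _           = trans (2*suc∸1 n) (ℕP.+-comm 1 (2 ℕ.* n))
2*∸1+2* (suc n) (suc i) (s<s i<n)   = trans (cong₂ _∸_ (ℕP.*-suc 2 n) (cong suc (ℕP.*-suc 2 i))) (2*∸1+2* n i i<n)

1+2*∸2* : ∀ n i → i ≤ n → suc (2 ℕ.* n) ∸ 2 ℕ.* i ≡ 2 ℕ.* (suc n ∸ i) ∸ 1
1+2*∸2* n i i≤n = begin
  suc (2 ℕ.* n) ∸ 2 ℕ.* i          ≡⟨ ℕP.+-∸-assoc 1 (ℕP.*-monoʳ-≤ 2 i≤n) ⟩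
  suc (2 ℕ.* n ∸ 2 ℕ.* i)          ≡⟨ cong suc (2*-∸ n i) ⟩
  suc (2 ℕ.* (n ∸ i))              ≡⟨ 2*suc∸1 (n ∸ i) ⟨
  2 ℕ.* suc (n ∸ i) ∸ 1            ≡⟨ cong (λ d → 2 ℕ.* d ∸ 1) (ℕP.+-∸-assoc 1 i≤n) ⟨
  2 ℕ.* (suc n ∸ i) ∸ 1            ∎

ι√-⊗-ι√-⊗-ι√ : ∀ a b c → ι√ a ⊗ ι√ b ⊗ ι√ c ≡ ι√ (a * b * c)
ι√-⊗-ι√-⊗-ι√ a b c = trans (cong (_⊗ ι√ c) (sym (ι√-homo-⊗ a b))) (sym (ι√-homo-⊗ (a * b) c))

even-term : ∀ b x y p i → ι√ b ⊗ (ι√ x ⊗ μ) ^ (2 ℕ.* i) ⊗ ι√ y ^ p ≡ ι√ (b * y ^ℚ p * x ^ℚ (2 ℕ.* i) * ⅕ ^ℚ i)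
even-term b x y p i = begin
  ι√ b ⊗ (ι√ x ⊗ μ) ^ (2 ℕ.* i) ⊗ ι√ y ^ p                     ≡⟨ cong₂ (λ e f → ι√ b ⊗ e ⊗ f) (ι√-μ-^-2* x i) (ι√-^ y p) ⟩
  ι√ b ⊗ ι√ (x ^ℚ (2 ℕ.* i) * ⅕ ^ℚ i) ⊗ ι√ (y ^ℚ p)            ≡⟨ ι√-⊗-ι√-⊗-ι√ b _ (y ^ℚ p) ⟩
  ι√ (b * (x ^ℚ (2 ℕ.* i) * ⅕ ^ℚ i) * y ^ℚ p)                  ≡⟨ cong ι√ (reorder b (x ^ℚ (2 ℕ.* i)) (⅕ ^ℚ i) (y ^ℚ p)) ⟩
  ι√ (b * y ^ℚ p * x ^ℚ (2 ℕ.* i) * ⅕ ^ℚ i)                    ∎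
  where
  reorder : ∀ b X Z Y → b * (X * Z) * Y ≡ b * Y * X * Z
  reorder = solve-∀ ℚ-ring

odd-term : ∀ b x y p i → ι√ b ⊗ (ι√ x ⊗ μ) ^ suc (2 ℕ.* i) ⊗ ι√ y ^ p ≡ ι√ (b * y ^ℚ p * x ^ℚ suc (2 ℕ.* i) * ⅕ ^ℚ i) ⊗ μ
odd-term b x y p i = begin
  ι√ b ⊗ (ι√ x ⊗ μ) ^ suc (2 ℕ.* i) ⊗ ι√ y ^ p                 ≡⟨ cong₂ (λ e f → ι√ b ⊗ e ⊗ f) (ι√-μ-^-1+2* x i) (ι√-^ y p) ⟩
  ι√ b ⊗ (ι√ (x ^ℚ suc (2 ℕ.* i) * ⅕ ^ℚ i) ⊗ μ) ⊗ ι√ (y ^ℚ p)  ≡⟨ swap (ι√ b) _ μ (ι√ (y ^ℚ p)) ⟩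
  ι√ b ⊗ ι√ (x ^ℚ suc (2 ℕ.* i) * ⅕ ^ℚ i) ⊗ ι√ (y ^ℚ p) ⊗ μ    ≡⟨ cong (_⊗ μ) (ι√-⊗-ι√-⊗-ι√ b _ (y ^ℚ p)) ⟩
  ι√ (b * (x ^ℚ suc (2 ℕ.* i) * ⅕ ^ℚ i) * y ^ℚ p) ⊗ μ          ≡⟨ cong (λ q → ι√ q ⊗ μ) (reorder b (x ^ℚ suc (2 ℕ.* i)) (⅕ ^ℚ i) (y ^ℚ p)) ⟩
  ι√ (b * y ^ℚ p * x ^ℚ suc (2 ℕ.* i) * ⅕ ^ℚ i) ⊗ μ            ∎
  where
  swap : ∀ b e m f → b ⊗ (e ⊗ m) ⊗ f ≡ b ⊗ e ⊗ f ⊗ m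
  swap = solve-∀ ℚ√5-ring
  reorder : ∀ b X Z Y → b * (X * Z) * Y ≡ b * Y * X * Z
  reorder = solve-∀ ℚ-ring

ι√-⊕-ι√-⊗-μ : ∀ x y → ι√ x ⊕ ι√ y ⊗ μ ≡ (x , - (⅕ * y))
ι√-⊕-ι√-⊗-μ x y = cong₂ _,_ (first x y) (second x y)
  where
  first : ∀ x y → x + (y * 0ℚ + + 5 / 1 * (0ℚ * - ⅕)) ≡ x
  first = solve-∀ ℚ-ring
  second : ∀ x y → 0ℚ + (y * - ⅕ + 0ℚ * 0ℚ) ≡ - (⅕ * y)
  second = solve-∀ ℚ-ring

summand-cong : ∀ {b b′ p p′ q q′} Z x y → b ≡ b′ → p ≡ p′ → q ≡ q′ →
               b * y ^ℚ p * x ^ℚ q * Z ≡ b′ * y ^ℚ p′ * x ^ℚ q′ * Z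
summand-cong Z x y refl refl refl = refl

evenTerm oddTerm evenTerm′ oddTerm′ : ℕ → ℕ → ℤ → ℕ → ℚ
evenTerm m n s k =
  binom (+ m ℤ.- + (2 ℕ.* n) ℤ.+ + (2 ℕ.* k)) (2 ℕ.* k) * (ι (F s) ^ℚ (2 ℕ.* (n ∸ k))) * (ι (L s) ^ℚ (2 ℕ.* k))
oddTerm m n s k =
  binom (+ m ℤ.- + (2 ℕ.* n) ℤ.+ + (2 ℕ.* k) ℤ.- + 1) (2 ℕ.* k ∸ 1) * (ι (F s) ^ℚ (2 ℕ.* (n ∸ k) ℕ.+ 1)) * (ι (L s) ^ℚ (2 ℕ.* k ∸ 1))
evenTerm′ m n s k =
  binom (+ m ℤ.- + (2 ℕ.* n) ℤ.+ + (2 ℕ.* k) ℤ.+ + 1) (2 ℕ.* k) * (ι (F s) ^ℚ (2 ℕ.* (n ∸ k) ∸ 1)) * (ι (L s) ^ℚ (2 ℕ.* k))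
oddTerm′ m n s k =
  binom (+ m ℤ.- + (2 ℕ.* n) ℤ.+ + (2 ℕ.* k)) (2 ℕ.* k ∸ 1) * (ι (F s) ^ℚ (2 ℕ.* (n ∸ k))) * (ι (L s) ^ℚ (2 ℕ.* k ∸ 1))

rhsTerm′ : (ℤ → ℤ) → ℕ → ℕ → ℤ → ℤ → ℕ → ℚ
rhsTerm′ X m n s t k =
  - ι (negOnePowℤ k) * binom (+ suc m) k * (ι (L s) ^ℚ k) * ι (X (s ℤ.* (+ (2 ℕ.* n) ℤ.- + k ℤ.- + 1) ℤ.+ t)) * (½ ^ℚ suc k)

even-expansion : ∀ m n s →
  homogeneous (λ j → binom (+ m ℤ.- + (2 ℕ.* n) ℤ.+ + j) j) (u s) (w s) (2 ℕ.* n)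
    ≡ ι√ (sumFrom 0 (suc n) (λ k → evenTerm m n s k * ⅕ ^ℚ k)) ⊕ ι√ (sumFrom 1 n (λ k → oddTerm m n s k * ⅕ ^ℚ (k ∸ 1))) ⊗ μ
even-expansion m n s = trans (Σ√-1+2* n T) (cong₂ _⊕_ evens odds)
  where
  Lₛ Fₛ : ℚ
  Lₛ = ι (L s)
  Fₛ = ι (F s)
  a : ℤ
  a = + m ℤ.- + (2 ℕ.* n)
  T : ℕ → ℚ√5
  T j = ι√ (binom (a ℤ.+ + j) j) ⊗ (ι√ Lₛ ⊗ μ) ^ j ⊗ ι√ Fₛ ^ (2 ℕ.* n ∸ j)
  evens : Σ√ 0 (suc n) (λ k → T (2 ℕ.* k)) ≡ ι√ (sumFrom 0 (suc n) (λ k → evenTerm m n s k * ⅕ ^ℚ k))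
  evens = trans (Σ√-cong (suc n) {λ k → T (2 ℕ.* k)} {λ k → ι√ (evenTerm m n s k * ⅕ ^ℚ k)}
                         (λ k _ → trans (even-term (binom (a ℤ.+ + (2 ℕ.* k)) (2 ℕ.* k)) Lₛ Fₛ (2 ℕ.* n ∸ 2 ℕ.* k) k)
                                 (cong (λ p → ι√ (binom (a ℤ.+ + (2 ℕ.* k)) (2 ℕ.* k) * Fₛ ^ℚ p * Lₛ ^ℚ (2 ℕ.* k) * ⅕ ^ℚ k)) (2*-∸ n k))))
                (Σ√-ι√ 0 (suc n) (λ k → evenTerm m n s k * ⅕ ^ℚ k))
  odd-index : ∀ i → a ℤ.+ + suc (2 ℕ.* i) ≡ a ℤ.+ + (2 ℕ.* suc i) ℤ.- + 1
  odd-index i = trans (lemma a (+ (2 ℕ.* i))) (cong (λ k → a ℤ.+ + k ℤ.- + 1) (sym (ℕP.*-suc 2 i)))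
    where
    lemma : ∀ a y → a ℤ.+ (+ 1 ℤ.+ y) ≡ a ℤ.+ (+ 1 ℤ.+ (+ 1 ℤ.+ y)) ℤ.- + 1
    lemma = ℤ-Solver.solve-∀
  odd : ∀ i → i < n → T (suc (2 ℕ.* i)) ≡ ι√ (oddTerm m n s (suc i) * ⅕ ^ℚ i) ⊗ μ
  odd i i<n = trans (odd-term (binom (a ℤ.+ + suc (2 ℕ.* i)) (suc (2 ℕ.* i))) Lₛ Fₛ (2 ℕ.* n ∸ suc (2 ℕ.* i)) i)
    (cong (λ q → ι√ q ⊗ μ) (summand-cong (⅕ ^ℚ i) Lₛ Fₛ
      (cong₂ binom (odd-index i) (sym (2*suc∸1 i))) (2*∸1+2* n i i<n) (sym (2*suc∸1 i))))
  odds : Σ√ 0 n (λ i → T (suc (2 ℕ.* i))) ≡ ι√ (sumFrom 1 n (λ k → oddTerm m n s k * ⅕ ^ℚ (k ∸ 1))) ⊗ μ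
  odds = trans (Σ√-cong n {λ i → T (suc (2 ℕ.* i))} {λ i → ι√ (oddTerm m n s (suc i) * ⅕ ^ℚ i) ⊗ μ} odd)
               (Σ√-ι√-⊗ n (λ k → oddTerm m n s k * ⅕ ^ℚ (k ∸ 1)) μ)

odd-expansion : ∀ m n s →
  homogeneous (λ j → binom (+ m ℤ.- + suc (2 ℕ.* n) ℤ.+ + j) j) (u s) (w s) (suc (2 ℕ.* n))
    ≡ ι√ (sumFrom 0 (suc n) (λ k → evenTerm′ m (suc n) s k * ⅕ ^ℚ k))
      ⊕ ι√ (sumFrom 1 (suc n) (λ k → oddTerm′ m (suc n) s k * ⅕ ^ℚ (k ∸ 1))) ⊗ μ
odd-expansion m n s = begin
  Σ√ 0 (suc (suc (2 ℕ.* n))) T                                       ≡⟨ cong (λ len → Σ√ 0 len T) (ℕP.*-suc 2 n) ⟨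
  Σ√ 0 (2 ℕ.* suc n) T                                               ≡⟨ Σ√-2* (suc n) T ⟩
  Σ√ 0 (suc n) (λ i → T (2 ℕ.* i)) ⊕ Σ√ 0 (suc n) (λ i → T (suc (2 ℕ.* i)))  ≡⟨ cong₂ _⊕_ evens odds ⟩
  ι√ (sumFrom 0 (suc n) (λ k → evenTerm′ m (suc n) s k * ⅕ ^ℚ k))
    ⊕ ι√ (sumFrom 1 (suc n) (λ k → oddTerm′ m (suc n) s k * ⅕ ^ℚ (k ∸ 1))) ⊗ μ ∎
  where
  Lₛ Fₛ : ℚ
  Lₛ = ι (L s)
  Fₛ = ι (F s)
  a : ℤ
  a = + m ℤ.- + suc (2 ℕ.* n)
  T : ℕ → ℚ√5
  T j = ι√ (binom (a ℤ.+ + j) j) ⊗ (ι√ Lₛ ⊗ μ) ^ j ⊗ ι√ Fₛ ^ (suc (2 ℕ.* n) ∸ j)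
  2*suc : + (2 ℕ.* suc n) ≡ + 1 ℤ.+ (+ 1 ℤ.+ + (2 ℕ.* n))
  2*suc = cong +_ (ℕP.*-suc 2 n)
  even-index : ∀ i → a ℤ.+ + (2 ℕ.* i) ≡ + m ℤ.- + (2 ℕ.* suc n) ℤ.+ + (2 ℕ.* i) ℤ.+ + 1
  even-index i = trans (lemma (+ m) (+ (2 ℕ.* n)) (+ (2 ℕ.* i))) (cong (λ x → + m ℤ.- x ℤ.+ + (2 ℕ.* i) ℤ.+ + 1) (sym 2*suc))
    where
    lemma : ∀ m x y → m ℤ.- (+ 1 ℤ.+ x) ℤ.+ y ≡ m ℤ.- (+ 1 ℤ.+ (+ 1 ℤ.+ x)) ℤ.+ y ℤ.+ + 1
    lemma = ℤ-Solver.solve-∀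
  odd-index : ∀ i → a ℤ.+ + suc (2 ℕ.* i) ≡ + m ℤ.- + (2 ℕ.* suc n) ℤ.+ + (2 ℕ.* suc i)
  odd-index i = trans (lemma (+ m) (+ (2 ℕ.* n)) (+ (2 ℕ.* i)))
                      (cong₂ (λ x y → + m ℤ.- x ℤ.+ y) (sym 2*suc) (cong +_ (sym (ℕP.*-suc 2 i))))
    where
    lemma : ∀ m x y → m ℤ.- (+ 1 ℤ.+ x) ℤ.+ (+ 1 ℤ.+ y) ≡ m ℤ.- (+ 1 ℤ.+ (+ 1 ℤ.+ x)) ℤ.+ (+ 1 ℤ.+ (+ 1 ℤ.+ y))
    lemma = ℤ-Solver.solve-∀
  even : ∀ i → i < suc n → T (2 ℕ.* i) ≡ ι√ (evenTerm′ m (suc n) s i * ⅕ ^ℚ i)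
  even i i<1+n = trans (even-term (binom (a ℤ.+ + (2 ℕ.* i)) (2 ℕ.* i)) Lₛ Fₛ (suc (2 ℕ.* n) ∸ 2 ℕ.* i) i)
    (cong ι√ (summand-cong (⅕ ^ℚ i) Lₛ Fₛ (cong (λ x → binom x (2 ℕ.* i)) (even-index i))
                                          (1+2*∸2* n i (ℕP.≤-pred i<1+n)) (refl {x = 2 ℕ.* i})))
  odd : ∀ i → i < suc n → T (suc (2 ℕ.* i)) ≡ ι√ (oddTerm′ m (suc n) s (suc i) * ⅕ ^ℚ i) ⊗ μ
  odd i _ = trans (odd-term (binom (a ℤ.+ + suc (2 ℕ.* i)) (suc (2 ℕ.* i))) Lₛ Fₛ (2 ℕ.* n ∸ 2 ℕ.* i) i)
    (cong (λ q → ι√ q ⊗ μ) (summand-cong (⅕ ^ℚ i) Lₛ Fₛ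
      (cong₂ binom (odd-index i) (sym (2*suc∸1 i))) (2*-∸ n i) (sym (2*suc∸1 i))))
  evens : Σ√ 0 (suc n) (λ i → T (2 ℕ.* i)) ≡ ι√ (sumFrom 0 (suc n) (λ k → evenTerm′ m (suc n) s k * ⅕ ^ℚ k))
  evens = trans (Σ√-cong (suc n) {λ i → T (2 ℕ.* i)} {λ i → ι√ (evenTerm′ m (suc n) s i * ⅕ ^ℚ i)} even)
                (Σ√-ι√ 0 (suc n) (λ k → evenTerm′ m (suc n) s k * ⅕ ^ℚ k))
  odds : Σ√ 0 (suc n) (λ i → T (suc (2 ℕ.* i))) ≡ ι√ (sumFrom 1 (suc n) (λ k → oddTerm′ m (suc n) s k * ⅕ ^ℚ (k ∸ 1))) ⊗ μ
  odds = trans (Σ√-cong (suc n) {λ i → T (suc (2 ℕ.* i))} {λ i → ι√ (oddTerm′ m (suc n) s (suc i) * ⅕ ^ℚ i) ⊗ μ} odd)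
               (Σ√-ι√-⊗ (suc n) (λ k → oddTerm′ m (suc n) s k * ⅕ ^ℚ (k ∸ 1)) μ)

κ-^-2* : ∀ n → κ ^ (2 ℕ.* n) ≡ ι√ ((+ 4 / 5) ^ℚ n)
κ-^-2* n = trans (^-2* κ n) (ι√-^ (+ 4 / 5) n)

even-identities : ∀ m n s t →
  let A = sumFrom 0 (suc n) (λ k → evenTerm m n s k * ⅕ ^ℚ k) in
  ( ι (L t) * A - ι (F t) * sumFrom 1 n (λ k → oddTerm m n s k * ⅕ ^ℚ (k ∸ 1))
  , ι (F t) * A - ι (L t) * sumFrom 1 n (λ k → oddTerm m n s k * ⅕ ^ℚ k))
  ≡ ( (+ 4 / 5) ^ℚ n * sumFrom 0 (suc (2 ℕ.* n)) (rhsTerm L m (2 ℕ.* n) s t)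
    , (+ 4 / 5) ^ℚ n * sumFrom 0 (suc (2 ℕ.* n)) (rhsTerm F m (2 ℕ.* n) s t))
even-identities m n s t = begin
  (Lₜ * A - Fₜ * B , Fₜ * A - Lₜ * sumFrom 1 n (λ k → oddTerm m n s k * ⅕ ^ℚ k))
    ≡⟨ cong₂ _,_ (first Lₜ Fₜ A B) (trans (cong (λ b → Fₜ * A - Lₜ * b) (sumFrom-1-^ℚ ⅕ n (oddTerm m n s))) (second Lₜ Fₜ A B)) ⟩
  ψ t ⊗ (A , - (⅕ * B))
    ≡⟨ cong (ψ t ⊗_) (trans (even-expansion m n s) (ι√-⊕-ι√-⊗-μ A B)) ⟨
  ψ t ⊗ homogeneous (λ j → binom (+ m ℤ.- + (2 ℕ.* n) ℤ.+ + j) j) (u s) (w s) (2 ℕ.* n)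
    ≡⟨ cong (ψ t ⊗_) (binomial-transform-φ (2 ℕ.* n) (+ m) s) ⟩
  ψ t ⊗ (κ ^ (2 ℕ.* n) ⊗ H)
    ≡⟨ cong (λ z → ψ t ⊗ (z ⊗ H)) (κ-^-2* n) ⟩
  ψ t ⊗ (ι√ c ⊗ H)
    ≡⟨ swap (ψ t) (ι√ c) H ⟩
  ι√ c ⊗ (ψ t ⊗ H)
    ≡⟨ cong (ι√ c ⊗_) (ψ-⊗-homogeneous (2 ℕ.* n) m s t) ⟩
  ι√ c ⊗ Σ√ 0 (suc (2 ℕ.* n)) (λ k → (rhsTerm L m (2 ℕ.* n) s t k , rhsTerm F m (2 ℕ.* n) s t k))
    ≡⟨ ι√-⊗ c _ _ ⟩
  (c * sumFrom 0 (suc (2 ℕ.* n)) (rhsTerm L m (2 ℕ.* n) s t) , c * sumFrom 0 (suc (2 ℕ.* n)) (rhsTerm F m (2 ℕ.* n) s t))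
    ∎
  where
  Lₜ Fₜ c A B : ℚ
  Lₜ = ι (L t)
  Fₜ = ι (F t)
  c = (+ 4 / 5) ^ℚ n
  A = sumFrom 0 (suc n) (λ k → evenTerm m n s k * ⅕ ^ℚ k)
  B = sumFrom 1 n (λ k → oddTerm m n s k * ⅕ ^ℚ (k ∸ 1))
  H : ℚ√5
  H = homogeneous (binom (+ suc m)) (ι√ (- ½ * ι (L s))) (φ s) (2 ℕ.* n)
  first : ∀ L F A B → L * A - F * B ≡ L * A + + 5 / 1 * (F * - (⅕ * B))
  first = solve-∀ ℚ-ring
  second : ∀ L F A B → F * A - L * (⅕ * B) ≡ L * - (⅕ * B) + F * A
  second = solve-∀ ℚ-ring
  swap : ∀ x y z → x ⊗ (y ⊗ z) ≡ y ⊗ (x ⊗ z)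
  swap = solve-∀ ℚ√5-ring

odd-identity-√5 : ∀ m n s t →
  ψ t ⊗ homogeneous (λ j → binom (+ m ℤ.- + suc (2 ℕ.* n) ℤ.+ + j) j) (u s) (w s) (suc (2 ℕ.* n)) ⊗ μ
    ≡ ι√ ((+ 4 / 5) ^ℚ suc n) ⊗ Σ√ 0 (2 ℕ.* suc n) (λ k → (rhsTerm′ L m (suc n) s t k , rhsTerm′ F m (suc n) s t k))
odd-identity-√5 m n s t = begin
  ψ t ⊗ homogeneous (λ j → binom (+ m ℤ.- + N ℤ.+ + j) j) (u s) (w s) N ⊗ μ
    ≡⟨ cong (λ z → ψ t ⊗ z ⊗ μ) (binomial-transform-φ N (+ m) s) ⟩
  ψ t ⊗ (κ ⊗ κ ^ (2 ℕ.* n) ⊗ H) ⊗ μ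
    ≡⟨ cong (λ z → ψ t ⊗ (κ ⊗ z ⊗ H) ⊗ μ) (κ-^-2* n) ⟩
  ψ t ⊗ (κ ⊗ ι√ ((+ 4 / 5) ^ℚ n) ⊗ H) ⊗ μ
    ≡⟨ regroup (ψ t) (ι√ ((+ 4 / 5) ^ℚ n)) H ⟩
  ι√ (+ 4 / 5) ⊗ ι√ ((+ 4 / 5) ^ℚ n) ⊗ (ι√ (- ½) ⊗ (ψ t ⊗ H))
    ≡⟨ cong₂ (λ a h → a ⊗ (ι√ (- ½) ⊗ h)) (sym (ι√-homo-⊗ (+ 4 / 5) ((+ 4 / 5) ^ℚ n))) (ψ-⊗-homogeneous N m s t) ⟩
  ι√ c ⊗ (ι√ (- ½) ⊗ Σ√ 0 (suc N) (λ k → (rhsTerm L m N s t k , rhsTerm F m N s t k)))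
    ≡⟨ cong (ι√ c ⊗_) (⊗-distribˡ-Σ√ (ι√ (- ½)) 0 (suc N) (λ k → (rhsTerm L m N s t k , rhsTerm F m N s t k))) ⟩
  ι√ c ⊗ Σ√ 0 (suc N) (λ k → ι√ (- ½) ⊗ (rhsTerm L m N s t k , rhsTerm F m N s t k))
    ≡⟨ cong (ι√ c ⊗_) (Σ√-cong (suc N) {g = λ k → (rhsTerm′ L m (suc n) s t k , rhsTerm′ F m (suc n) s t k)} halve) ⟩
  ι√ c ⊗ Σ√ 0 (suc N) (λ k → (rhsTerm′ L m (suc n) s t k , rhsTerm′ F m (suc n) s t k))
    ≡⟨ cong (λ len → ι√ c ⊗ Σ√ 0 len (λ k → (rhsTerm′ L m (suc n) s t k , rhsTerm′ F m (suc n) s t k))) (ℕP.*-suc 2 n) ⟨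
  ι√ c ⊗ Σ√ 0 (2 ℕ.* suc n) (λ k → (rhsTerm′ L m (suc n) s t k , rhsTerm′ F m (suc n) s t k))
    ∎
  where
  N : ℕ
  N = suc (2 ℕ.* n)
  c : ℚ
  c = (+ 4 / 5) ^ℚ suc n
  H : ℚ√5
  H = homogeneous (binom (+ suc m)) (ι√ (- ½ * ι (L s))) (φ s) N
  -- κ ⊗ μ = -2/5 = (4/5)·(-1/2)
  regroup : ∀ p q h → p ⊗ (κ ⊗ q ⊗ h) ⊗ μ ≡ ι√ (+ 4 / 5) ⊗ q ⊗ (ι√ (- ½) ⊗ (p ⊗ h))
  regroup = solve-∀ ℚ√5-ring
  index : ∀ k → + N ℤ.- + k ≡ + (2 ℕ.* suc n) ℤ.- + k ℤ.- + 1
  index k = trans (lemma (+ (2 ℕ.* n)) (+ k)) (cong (λ x → + x ℤ.- + k ℤ.- + 1) (sym (ℕP.*-suc 2 n)))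
    where
    lemma : ∀ x k → + 1 ℤ.+ x ℤ.- k ≡ + 1 ℤ.+ (+ 1 ℤ.+ x) ℤ.- k ℤ.- + 1
    lemma = ℤ-Solver.solve-∀
  halve-term : ∀ X k → - ½ * rhsTerm X m N s t k ≡ rhsTerm′ X m (suc n) s t k
  halve-term X k =
    trans (reorder (ι (negOnePowℤ k)) (binom (+ suc m) k) (ι (L s) ^ℚ k) (ι (X (s ℤ.* (+ N ℤ.- + k) ℤ.+ t))) (½ ^ℚ k))
          (cong (λ i → - ι (negOnePowℤ k) * binom (+ suc m) k * ι (L s) ^ℚ k * ι (X (s ℤ.* i ℤ.+ t)) * (½ * ½ ^ℚ k)) (index k))
    where
    reorder : ∀ σ b P x H → - ½ * (σ * b * P * x * H) ≡ - σ * b * P * x * (½ * H)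
    reorder = solve-∀ ℚ-ring
  halve : ∀ k → k < suc N →
    ι√ (- ½) ⊗ (rhsTerm L m N s t k , rhsTerm F m N s t k) ≡ (rhsTerm′ L m (suc n) s t k , rhsTerm′ F m (suc n) s t k)
  halve k _ = trans (ι√-⊗ (- ½) (rhsTerm L m N s t k) (rhsTerm F m N s t k)) (cong₂ _,_ (halve-term L k) (halve-term F k))

odd-identities : ∀ m n s t →
  let C = sumFrom 1 n (λ k → oddTerm′ m n s k * ⅕ ^ℚ k) in
  ( ι (L t) * C - ι (F t) * sumFrom 0 n (λ k → evenTerm′ m n s k * ⅕ ^ℚ k)
  , ι (F t) * C - ι (L t) * sumFrom 0 n (λ k → evenTerm′ m n s k * ⅕ ^ℚ suc k))
  ≡ ( (+ 4 / 5) ^ℚ n * sumFrom 0 (2 ℕ.* n) (rhsTerm′ L m n s t)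
    , (+ 4 / 5) ^ℚ n * sumFrom 0 (2 ℕ.* n) (rhsTerm′ F m n s t))
odd-identities m zero    s t = cong₂ _,_ (vanish (ι (L t)) (ι (F t))) (vanish (ι (F t)) (ι (L t)))
  where
  vanish : ∀ a b → a * 0ℚ - b * 0ℚ ≡ 1ℚ * 0ℚ
  vanish = solve-∀ ℚ-ring
odd-identities m (suc n) s t = begin
  (Lₜ * C - Fₜ * D , Fₜ * C - Lₜ * sumFrom 0 (suc n) (λ k → evenTerm′ m (suc n) s k * ⅕ ^ℚ suc k))
    ≡⟨ cong₂ (λ c d → (Lₜ * c - Fₜ * D , Fₜ * c - Lₜ * d)) (sumFrom-1-^ℚ ⅕ (suc n) (oddTerm′ m (suc n) s))
                                                          (sumFrom-^ℚ-suc ⅕ (suc n) (evenTerm′ m (suc n) s)) ⟩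
  (Lₜ * (⅕ * C₀) - Fₜ * D , Fₜ * (⅕ * C₀) - Lₜ * (⅕ * D))
    ≡⟨ cong₂ _,_ (first Lₜ Fₜ D C₀) (second Lₜ Fₜ D C₀) ⟩
  ψ t ⊗ (D , - (⅕ * C₀)) ⊗ μ
    ≡⟨ cong (λ z → ψ t ⊗ z ⊗ μ) (trans (odd-expansion m n s) (ι√-⊕-ι√-⊗-μ D C₀)) ⟨
  ψ t ⊗ homogeneous (λ j → binom (+ m ℤ.- + suc (2 ℕ.* n) ℤ.+ + j) j) (u s) (w s) (suc (2 ℕ.* n)) ⊗ μ
    ≡⟨ odd-identity-√5 m n s t ⟩
  ι√ c ⊗ Σ√ 0 (2 ℕ.* suc n) (λ k → (rhsTerm′ L m (suc n) s t k , rhsTerm′ F m (suc n) s t k))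
    ≡⟨ ι√-⊗ c _ _ ⟩
  (c * sumFrom 0 (2 ℕ.* suc n) (rhsTerm′ L m (suc n) s t) , c * sumFrom 0 (2 ℕ.* suc n) (rhsTerm′ F m (suc n) s t))
    ∎
  where
  Lₜ Fₜ c C₀ C D : ℚ
  Lₜ = ι (L t)
  Fₜ = ι (F t)
  c = (+ 4 / 5) ^ℚ suc n
  C₀ = sumFrom 1 (suc n) (λ k → oddTerm′ m (suc n) s k * ⅕ ^ℚ (k ∸ 1))
  C = sumFrom 1 (suc n) (λ k → oddTerm′ m (suc n) s k * ⅕ ^ℚ k)
  D = sumFrom 0 (suc n) (λ k → evenTerm′ m (suc n) s k * ⅕ ^ℚ k)
  first : ∀ L F D C → L * (⅕ * C) - F * D
                    ≡ (L * D + + 5 / 1 * (F * - (⅕ * C))) * 0ℚ + + 5 / 1 * ((L * - (⅕ * C) + F * D) * - ⅕)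
  first = solve-∀ ℚ-ring
  second : ∀ L F D C → F * (⅕ * C) - L * (⅕ * D)
                     ≡ (L * D + + 5 / 1 * (F * - (⅕ * C))) * - ⅕ + (L * - (⅕ * C) + F * D) * 0ℚ
  second = solve-∀ ℚ-ring

theorem9 : (m n : ℕ) (s t : ℤ) →
  ((ι (L t) * sumFrom 0 (ℕ.suc n) (λ k → binom (+ m ℤ.- + (2 ℕ.* n) ℤ.+ + (2 ℕ.* k)) (2 ℕ.* k) * (ι (F s) ^ℚ (2 ℕ.* (n ∸ k))) * (ι (L s) ^ℚ (2 ℕ.* k)) * ((+ 1 / 5) ^ℚ k))
    - ι (F t) * sumFrom 1 n (λ k → binom (+ m ℤ.- + (2 ℕ.* n) ℤ.+ + (2 ℕ.* k) ℤ.- + 1) (2 ℕ.* k ∸ 1) * (ι (F s) ^ℚ (2 ℕ.* (n ∸ k) ℕ.+ 1)) * (ι (L s) ^ℚ (2 ℕ.* k ∸ 1)) * ((+ 1 / 5) ^ℚ (k ∸ 1))))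
    ≡ ((+ 4 / 5) ^ℚ n) * sumFrom 0 (ℕ.suc (2 ℕ.* n)) (λ k → ι (negOnePowℤ k) * binom (+ (ℕ.suc m)) k * (ι (L s) ^ℚ k) * ι (L (s ℤ.* (+ (2 ℕ.* n) ℤ.- + k) ℤ.+ t)) * ((+ 1 / 2) ^ℚ k)))
  × ((ι (F t) * sumFrom 0 (ℕ.suc n) (λ k → binom (+ m ℤ.- + (2 ℕ.* n) ℤ.+ + (2 ℕ.* k)) (2 ℕ.* k) * (ι (F s) ^ℚ (2 ℕ.* (n ∸ k))) * (ι (L s) ^ℚ (2 ℕ.* k)) * ((+ 1 / 5) ^ℚ k))
    - ι (L t) * sumFrom 1 n (λ k → binom (+ m ℤ.- + (2 ℕ.* n) ℤ.+ + (2 ℕ.* k) ℤ.- + 1) (2 ℕ.* k ∸ 1) * (ι (F s) ^ℚ (2 ℕ.* (n ∸ k) ℕ.+ 1)) * (ι (L s) ^ℚ (2 ℕ.* k ∸ 1)) * ((+ 1 / 5) ^ℚ k)))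
    ≡ ((+ 4 / 5) ^ℚ n) * sumFrom 0 (ℕ.suc (2 ℕ.* n)) (λ k → ι (negOnePowℤ k) * binom (+ (ℕ.suc m)) k * (ι (L s) ^ℚ k) * ι (F (s ℤ.* (+ (2 ℕ.* n) ℤ.- + k) ℤ.+ t)) * ((+ 1 / 2) ^ℚ k)))
  × ((ι (L t) * sumFrom 1 n (λ k → binom (+ m ℤ.- + (2 ℕ.* n) ℤ.+ + (2 ℕ.* k)) (2 ℕ.* k ∸ 1) * (ι (F s) ^ℚ (2 ℕ.* (n ∸ k))) * (ι (L s) ^ℚ (2 ℕ.* k ∸ 1)) * ((+ 1 / 5) ^ℚ k))
    - ι (F t) * sumFrom 0 n (λ k → binom (+ m ℤ.- + (2 ℕ.* n) ℤ.+ + (2 ℕ.* k) ℤ.+ + 1) (2 ℕ.* k) * (ι (F s) ^ℚ (2 ℕ.* (n ∸ k) ∸ 1)) * (ι (L s) ^ℚ (2 ℕ.* k)) * ((+ 1 / 5) ^ℚ k)))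
    ≡ ((+ 4 / 5) ^ℚ n) * sumFrom 0 (2 ℕ.* n) (λ k → - ι (negOnePowℤ k) * binom (+ (ℕ.suc m)) k * (ι (L s) ^ℚ k) * ι (L (s ℤ.* (+ (2 ℕ.* n) ℤ.- + k ℤ.- + 1) ℤ.+ t)) * ((+ 1 / 2) ^ℚ (ℕ.suc k))))
  × ((ι (F t) * sumFrom 1 n (λ k → binom (+ m ℤ.- + (2 ℕ.* n) ℤ.+ + (2 ℕ.* k)) (2 ℕ.* k ∸ 1) * (ι (F s) ^ℚ (2 ℕ.* (n ∸ k))) * (ι (L s) ^ℚ (2 ℕ.* k ∸ 1)) * ((+ 1 / 5) ^ℚ k))
    - ι (L t) * sumFrom 0 n (λ k → binom (+ m ℤ.- + (2 ℕ.* n) ℤ.+ + (2 ℕ.* k) ℤ.+ + 1) (2 ℕ.* k) * (ι (F s) ^ℚ (2 ℕ.* (n ∸ k) ∸ 1)) * (ι (L s) ^ℚ (2 ℕ.* k)) * ((+ 1 / 5) ^ℚ (ℕ.suc k))))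
    ≡ ((+ 4 / 5) ^ℚ n) * sumFrom 0 (2 ℕ.* n) (λ k → - ι (negOnePowℤ k) * binom (+ (ℕ.suc m)) k * (ι (L s) ^ℚ k) * ι (F (s ℤ.* (+ (2 ℕ.* n) ℤ.- + k ℤ.- + 1) ℤ.+ t)) * ((+ 1 / 2) ^ℚ (ℕ.suc k))))

theorem9 m n s t =
  cong proj₁ (even-identities m n s t) , cong proj₂ (even-identities m n s t) ,
  cong proj₁ (odd-identities m n s t) , cong proj₂ (odd-identities m n s t)
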